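{- Let $m,r\ge 0$ be integers with $(m,r)$ belonging to the set $$\{(m,0),(m,1),(1,r),(2,2),(2,3),(3,2)\colon m,r\geq 1\}.$$ Then for every positive integer $n$, $$\sum_{k=0}^{n-1}(-1)^{rk}\big((m+1)k+m\big)M_{m,k}^{(r)}\equiv 0 \pmod{mn},$$ where $M_{m,k}^{(r)}=\sum_{k_1+\cdots+k_m=k}\binom{k}{k_1,\ldots,k_m}^r$.
   Context: For integers $m\ge1$, $k\ge 0$, $r\ge 0$, define $M_{m,k}^{(r)}=\sum_{k_1+\cdots+k_m=k}\binom{k}{k_1,\ldots,k_m}^r$, the sum running over all $m$-tuples of nonnegative integers $(k_1,\ldots,k_m)$ with sum $k$, where $\binom{k}{k_1,\ldots,k_m}=\frac{k!}{k_1!\cdots k_m!}$ is the multinomial coefficient. In particular $M_{2,k}^{(r)}=\sum_{j=0}^k\binom{k}{j}^r$. -}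

module Defs where

open import Data.Nat using (ℕ; zero; suc; _+_; _*_; _∸_; _^_; _!; NonZero; _/_)
open import Data.Nat.Properties using (_!≢0; m*n≢0)
open import Data.List using (List; []; _∷_; map; concatMap; upTo)
open import Data.Nat.ListAction using (sum)
open import Data.Vec using (Vec; []; _∷_)
open import Data.Integer as ℤ using (ℤ; +_; -_)

compositions : (m k : ℕ) → List (Vec ℕ m)
compositions zero    zero    = [] ∷ []
compositions zero    (suc k) = []
compositions (suc m) k       =
  concatMap (λ j → map (j ∷_) (compositions m (k ∸ j))) (upTo (suc k))

factProd : {m : ℕ} → Vec ℕ m → ℕ
factProd []       = 1
factProd (j ∷ v)  = j ! * factProd v

factProd≢0 : {m : ℕ} (v : Vec ℕ m) → NonZero (factProd v)
factProd≢0 []      = _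
factProd≢0 (j ∷ v) = m*n≢0 (j !) (factProd v) {{j !≢0}} {{factProd≢0 v}}

multinomial : {m : ℕ} (k : ℕ) → Vec ℕ m → ℕ
multinomial k v = (k ! / factProd v) {{factProd≢0 v}}

M : (m k r : ℕ) → ℕ
M m k r = sum (map (λ v → multinomial k v ^ r) (compositions m k))

signPow : ℕ → ℤ
signPow zero    = ℤ.+ 1
signPow (suc e) = ℤ.- signPow e

S : (m r n : ℕ) → ℤ
S m r n = Data.List.foldr ℤ._+_ (ℤ.+ 0)
  (map (λ k → signPow (r * k) ℤ.* (ℤ.+ (((m + 1) * k + m) * M m k r))) (upTo n))

data Admissible : ℕ → ℕ → Set where
  r0   : ∀ m → 1 Data.Nat.≤ m → Admissible m 0
  r1   : ∀ m → 1 Data.Nat.≤ m → Admissible m 1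
  m1   : ∀ r → 1 Data.Nat.≤ r → Admissible 1 r
  p22  : Admissible 2 2
  p23  : Admissible 2 3
  p32  : Admissible 3 2

module Submission where

-- Every case is proved by telescoping: we find T with c·(k-th summand) =
-- T(k+1) - T(k) and T(0) = 0, so that c·S = T(n), and then read off the
-- divisibility from T(n).  To find T we need closed forms or recurrences for
-- the multinomial sums M_{m,k}^{(r)}:
--  * peeling off the first part of a composition gives
--    M_{m+1,k} = Σⱼ C(k,j)^r M_{m,k-j}, hence M_{1,k} = 1, M_{m+1,k}^{(0)} = C(k+m,m)
--    (Pascal's rule), M_{m,k}^{(1)} = m^k (binomial theorem), M_{2,k}^{(r)} = Σⱼ C(k,j)^r
--    and M_{3,k}^{(2)} = Σⱼ C(k,j)² M_{2,j}^{(2)};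
--  * the sequences M_{2,k}^{(2)}, M_{2,k}^{(3)} (Franel numbers) and M_{3,k}^{(2)} satisfy
--    recurrences proved by creative telescoping; each certificate identity is
--    reduced to a polynomial identity, by scaling the binomial coefficients
--    near C(n+1,j) to polynomial multiples of it;
--  * the needed congruences come from x² ≡ x (mod 2), x³ ≡ x (mod 6), Σⱼ C(k,j) = 2^k,
--    and, for 3 ∣ k·M_{3,k}^{(2)}, the recurrence read modulo 3.
-- The file develops finite sums, binomial coefficients, the multinomial sums,
-- creative telescoping with the three recurrences, the congruences, and
-- finally the six cases of the proposition.

open import Data.Nat as ℕ using (ℕ; zero; suc; _≤_; _<_; _∸_; _!)
import Data.Nat.Properties as ℕ
import Data.Nat.Divisibility as ℕ
import Data.Nat.Tactic.RingSolver as ℕ-Solver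
open import Data.Nat.Combinatorics
  using (_C_; nCk+nC[k+1]≡[n+1]C[k+1]; nC1≡n; nCn≡1; nCk≡nC[n∸k]; nCk≡n!/k![n-k]!; k![n∸k]!∣n!; k>n⇒nCk≡0)
open import Data.Nat.DivMod using (_/_; m*n/n≡m; m*[n/m]≡n)
open import Data.Nat.ListAction using (sum)
open import Data.Nat.ListAction.Properties using (sum-++)
open import Data.Nat.Primality using (Prime; prime?; euclidsLemma)
open import Data.Integer using (ℤ; +_; -_; _+_; _-_; _*_; _^_; 0ℤ; 1ℤ; ∣_∣; +-0-rawMonoid)
import Data.Integer.Properties as ℤ
import Data.Integer.Divisibility as Unsigned
open import Data.Integer.Divisibility.Signed
  using (_∣_; divides; ∣m∣n⇒∣m+n; ∣m∣n⇒∣m-n; ∣n⇒∣m*n; ∣m⇒∣m*n; ∣⇒∣ᵤ; ∣ᵤ⇒∣; *-monoʳ-∣)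
open import Data.Integer.Tactic.RingSolver using (solve-∀)
open import Data.Fin using (Fin; toℕ)
import Data.Vec.Functional as Vec
open import Data.Vec using (Vec; []; _∷_)
open import Data.List using (List; []; _∷_; _++_; map; concatMap; upTo; applyUpTo; foldr)
open import Data.List.Properties using (map-++; map-∘; map-cong; map-cong-local)
open import Data.List.Relation.Unary.All as All using (All; []; _∷_)
open import Data.List.Relation.Unary.All.Properties using (concat⁺; map⁺; applyUpTo⁺₁)
open import Data.Product using (_×_; _,_)
open import Data.Sum using (_⊎_; inj₁; inj₂; map₂)
open import Data.Empty using (⊥-elim)
open import Function using (_∘_)
open import Relation.Nullary.Decidable using (from-yes)
open import Relation.Binary.PropositionalEquality
  using (_≡_; _≢_; refl; sym; trans; cong; cong₂; subst; module ≡-Reasoning)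
open import Algebra.Properties.CommutativeSemiring.Binomial ℤ.+-*-commutativeSemiring
  using () renaming (theorem to binomial-expansion)
import Algebra.Properties.Semiring.Exp as Exp
import Algebra.Definitions.RawMonoid as RawMonoid
open import Defs

∑ : ℕ → (ℕ → ℤ) → ℤ
∑ zero    f = 0ℤ
∑ (suc n) f = ∑ n f + f n

∑-cong : ∀ n {f g : ℕ → ℤ} → (∀ {j} → j < n → f j ≡ g j) → ∑ n f ≡ ∑ n g
∑-cong zero    f≡g = refl
∑-cong (suc n) f≡g = cong₂ _+_ (∑-cong n (f≡g ∘ ℕ.m<n⇒m<1+n)) (f≡g ℕ.≤-refl)

∑-head : ∀ n (f : ℕ → ℤ) → ∑ (suc n) f ≡ f 0 + ∑ n (f ∘ suc)
∑-head zero    f = ℤ.+-comm 0ℤ (f 0)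
∑-head (suc n) f = trans (cong (_+ f (suc n)) (∑-head n f))
                         (ℤ.+-assoc (f 0) (∑ n (f ∘ suc)) (f (suc n)))

∑-+ : ∀ n (f g : ℕ → ℤ) → ∑ n (λ j → f j + g j) ≡ ∑ n f + ∑ n g
∑-+ zero    f g = refl
∑-+ (suc n) f g = trans (cong (_+ (f n + g n)) (∑-+ n f g))
                        (shuffle (∑ n f) (∑ n g) (f n) (g n))
  where
  shuffle : ∀ a b c d → a + b + (c + d) ≡ a + c + (b + d)
  shuffle = solve-∀

∑-*ˡ : ∀ n c (f : ℕ → ℤ) → ∑ n (λ j → c * f j) ≡ c * ∑ n f
∑-*ˡ zero    c f = sym (ℤ.*-zeroʳ c)
∑-*ˡ (suc n) c f = trans (cong (_+ c * f n) (∑-*ˡ n c f))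
                         (sym (ℤ.*-distribˡ-+ c (∑ n f) (f n)))

∑-telescope : ∀ n (g : ℕ → ℤ) → ∑ n (λ j → g (suc j) - g j) ≡ g n - g 0
∑-telescope zero    g = sym (ℤ.+-inverseʳ (g 0))
∑-telescope (suc n) g = trans (cong (_+ (g (suc n) - g n)) (∑-telescope n g))
                              (collapse (g 0) (g n) (g (suc n)))
  where
  collapse : ∀ a b c → b - a + (c - b) ≡ c - a
  collapse = solve-∀

∑-pad : ∀ n e (f : ℕ → ℤ) → (∀ {j} → n ≤ j → f j ≡ 0ℤ) → ∑ (e ℕ.+ n) f ≡ ∑ n f
∑-pad n zero    f vanish = refl
∑-pad n (suc e) f vanish = trans (cong₂ _+_ (∑-pad n e f vanish) (vanish (ℕ.m≤n+m n e)))
                                 (ℤ.+-identityʳ (∑ n f))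

∑-reverse : ∀ n (f : ℕ → ℤ) → ∑ n f ≡ ∑ n (λ j → f (n ℕ.∸ suc j))
∑-reverse zero    f = refl
∑-reverse (suc n) f = begin
  ∑ n f + f n                               ≡⟨ cong (_+ f n) (∑-reverse n f) ⟩
  ∑ n (λ j → f (n ℕ.∸ suc j)) + f n         ≡⟨ ℤ.+-comm _ (f n) ⟩
  f n + ∑ n (λ j → f (n ℕ.∸ suc j))         ≡⟨ sym (∑-head n (λ j → f (suc n ℕ.∸ suc j))) ⟩
  ∑ (suc n) (λ j → f (suc n ℕ.∸ suc j))     ∎
  where open ≡-Reasoning

∑-- : ∀ n (f g : ℕ → ℤ) → ∑ n (λ j → f j - g j) ≡ ∑ n f - ∑ n g
∑-- zero    f g = refl
∑-- (suc n) f g = trans (cong (_+ (f n - g n)) (∑-- n f g))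
                        (shuffle (∑ n f) (∑ n g) (f n) (g n))
  where
  shuffle : ∀ a b c d → a - b + (c - d) ≡ a + c - (b + d)
  shuffle = solve-∀

∑-∣ : ∀ n d (f : ℕ → ℤ) → (∀ {j} → j < n → d ∣ f j) → d ∣ ∑ n f
∑-∣ zero    d f d∣f = divides 0ℤ (sym (ℤ.*-zeroˡ d))
∑-∣ (suc n) d f d∣f = ∣m∣n⇒∣m+n (∑-∣ n d f (d∣f ∘ ℕ.m<n⇒m<1+n)) (d∣f ℕ.≤-refl)

∑-zero : ∀ n (f : ℕ → ℤ) → (∀ {j} → j < n → f j ≡ 0ℤ) → ∑ n f ≡ 0ℤ
∑-zero zero    f vanish = refl
∑-zero (suc n) f vanish = cong₂ _+_ (∑-zero n f (vanish ∘ ℕ.m<n⇒m<1+n)) (vanish ℕ.≤-refl)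

∑-telescope₀ : ∀ n (f g : ℕ → ℤ) → f 0 ≡ g 0 → (∀ j → f (suc j) ≡ g (suc j) - g j) → ∑ (suc n) f ≡ g n
∑-telescope₀ n f g base step = begin
  ∑ (suc n) f                         ≡⟨ ∑-head n f ⟩
  f 0 + ∑ n (f ∘ suc)                 ≡⟨ cong₂ _+_ base (trans (∑-cong n (λ {j} _ → step j)) (∑-telescope n g)) ⟩
  g 0 + (g n - g 0)                   ≡⟨ cancel (g 0) (g n) ⟩
  g n                                 ∎
  where
  open ≡-Reasoning
  cancel : ∀ a b → a + (b - a) ≡ b
  cancel = solve-∀

foldr-applyUpTo : ∀ n (f : ℕ → ℤ) (g : ℕ → ℕ) → foldr _+_ 0ℤ (map f (applyUpTo g n)) ≡ ∑ n (f ∘ g)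
foldr-applyUpTo zero    f g = refl
foldr-applyUpTo (suc n) f g =
  trans (cong (λ s → f (g 0) + s) (foldr-applyUpTo n f (g ∘ suc))) (sym (∑-head n (f ∘ g)))

pascal : ∀ n k → suc n C suc k ≡ n C k ℕ.+ n C suc k
pascal n k = sym (nCk+nC[k+1]≡[n+1]C[k+1] n k)

absorption : ∀ n k → suc k ℕ.* (suc n C suc k) ≡ suc n ℕ.* (n C k)
absorption zero    zero    = refl
absorption zero    (suc k) = ℕ.*-zeroʳ (suc (suc k))
absorption (suc n) zero    = trans (ℕ.*-identityˡ _) (trans (nC1≡n (suc (suc n))) (sym (ℕ.*-identityʳ _)))
absorption (suc n) (suc k) = begin
  suc (suc k) ℕ.* (suc (suc n) C suc (suc k))
    ≡⟨ cong (suc (suc k) ℕ.*_) (pascal (suc n) (suc k)) ⟩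
  suc (suc k) ℕ.* (X ℕ.+ Y)
    ≡⟨ split k X Y ⟩
  X ℕ.+ (suc k ℕ.* X ℕ.+ suc (suc k) ℕ.* Y)
    ≡⟨ cong₂ (λ a b → X ℕ.+ (a ℕ.+ b)) (absorption n k) (absorption n (suc k)) ⟩
  X ℕ.+ (suc n ℕ.* (n C k) ℕ.+ suc n ℕ.* (n C suc k))
    ≡⟨ cong (X ℕ.+_) (trans (sym (ℕ.*-distribˡ-+ (suc n) (n C k) (n C suc k))) (cong (suc n ℕ.*_) (sym (pascal n k)))) ⟩
  X ℕ.+ suc n ℕ.* X
    ≡⟨⟩
  suc (suc n) ℕ.* X ∎
  where
  open ≡-Reasoning
  X Y : ℕ
  X = suc n C suc k
  Y = suc n C suc (suc k)
  split : ∀ k X Y → suc (suc k) ℕ.* (X ℕ.+ Y) ≡ X ℕ.+ (suc k ℕ.* X ℕ.+ suc (suc k) ℕ.* Y)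
  split = ℕ-Solver.solve-∀

_Cℤ_ : ℕ → ℕ → ℤ
n Cℤ k = + (n C k)

absorptionℤ : ∀ n k → + suc k * (suc n Cℤ suc k) ≡ + suc n * (n Cℤ k)
absorptionℤ n k = trans (sym (ℤ.pos-* (suc k) _)) (trans (cong +_ (absorption n k)) (ℤ.pos-* (suc n) _))

row-ratio : ∀ n k → + suc k * (n Cℤ suc k) ≡ (+ n - + k) * (n Cℤ k)
row-ratio n k = begin
  K₁ * b               ≡⟨ isolate K₁ a b ⟩
  K₁ * (a + b) - K₁ * a ≡⟨ cong (_- K₁ * a) whole ⟩
  N₁ * a - K₁ * a       ≡⟨ difference (+ n) (+ k) a ⟩
  (+ n - + k) * a       ∎
  where
  open ≡-Reasoning
  K₁ N₁ a b : ℤ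
  K₁ = + suc k
  N₁ = + suc n
  a = n Cℤ k
  b = n Cℤ suc k
  whole : K₁ * (a + b) ≡ N₁ * a
  whole = trans (cong (K₁ *_) (trans (sym (ℤ.pos-+ (n C k) _)) (cong +_ (sym (pascal n k)))))
                (absorptionℤ n k)
  isolate : ∀ K a b → K * b ≡ K * (a + b) - K * a
  isolate = solve-∀
  difference : ∀ N K a → (+ 1 + N) * a - (+ 1 + K) * a ≡ (N - K) * a
  difference = solve-∀

column-ratio : ∀ n k → (+ suc n - + k) * (suc n Cℤ k) ≡ + suc n * (n Cℤ k)
column-ratio n zero    = cong (_* 1ℤ) (ℤ.+-identityʳ (+ suc n))
column-ratio n (suc k) = ℤ.*-cancelˡ-≡ (+ suc k) _ _ (begin
  K₁ * ((+ suc n - + suc k) * (suc n Cℤ suc k)) ≡⟨ cong (λ d → K₁ * (d * (suc n Cℤ suc k))) (shift (+ n) (+ k)) ⟩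
  K₁ * ((+ n - + k) * (suc n Cℤ suc k))         ≡⟨ swap K₁ (+ n - + k) (suc n Cℤ suc k) ⟩
  (+ n - + k) * (K₁ * (suc n Cℤ suc k))         ≡⟨ cong ((+ n - + k) *_) (absorptionℤ n k) ⟩
  (+ n - + k) * (+ suc n * (n Cℤ k))            ≡⟨ swap (+ n - + k) (+ suc n) (n Cℤ k) ⟩
  + suc n * ((+ n - + k) * (n Cℤ k))            ≡⟨ cong (+ suc n *_) (sym (row-ratio n k)) ⟩
  + suc n * (K₁ * (n Cℤ suc k))                 ≡⟨ swap (+ suc n) K₁ (n Cℤ suc k) ⟩
  K₁ * (+ suc n * (n Cℤ suc k))                 ∎)
  where
  open ≡-Reasoning
  K₁ : ℤ
  K₁ = + suc k
  swap : ∀ a b c → a * (b * c) ≡ b * (a * c)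
  swap = solve-∀
  shift : ∀ N K → (+ 1 + N) - (+ 1 + K) ≡ N - K
  shift = solve-∀

-- The window of binomial coefficients around X = C(n+1,j): after scaling by
-- μ = (n+1)(j+1), each of them is a polynomial multiple of X.
module Window (n j : ℕ) where

  N₁ J₁ X μ : ℤ
  N₁ = + suc n
  J₁ = + suc j
  X  = suc n Cℤ j
  μ  = N₁ * J₁

  private
    open ≡-Reasoning
    reassoc : ∀ a b c → a * b * c ≡ b * (a * c)
    reassoc = solve-∀
    reassoc′ : ∀ a b c → a * (b * c) ≡ a * b * c
    reassoc′ = solve-∀
    swap : ∀ a b c → a * (b * c) ≡ b * (a * c)
    swap = solve-∀

  C[n,j] : μ * (n Cℤ j) ≡ J₁ * (N₁ - + j) * X
  C[n,j] = begin
    μ * (n Cℤ j)            ≡⟨ reassoc N₁ J₁ (n Cℤ j) ⟩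
    J₁ * (N₁ * (n Cℤ j))    ≡⟨ cong (J₁ *_) (sym (column-ratio n j)) ⟩
    J₁ * ((N₁ - + j) * X)   ≡⟨ reassoc′ J₁ (N₁ - + j) X ⟩
    J₁ * (N₁ - + j) * X     ∎

  C[n,j+1] : μ * (n Cℤ suc j) ≡ (+ n - + j) * (N₁ - + j) * X
  C[n,j+1] = begin
    μ * (n Cℤ suc j)               ≡⟨ ℤ.*-assoc N₁ J₁ (n Cℤ suc j) ⟩
    N₁ * (J₁ * (n Cℤ suc j))       ≡⟨ cong (N₁ *_) (row-ratio n j) ⟩
    N₁ * ((+ n - + j) * (n Cℤ j))  ≡⟨ swap N₁ (+ n - + j) (n Cℤ j) ⟩
    (+ n - + j) * (N₁ * (n Cℤ j))  ≡⟨ cong ((+ n - + j) *_) (sym (column-ratio n j)) ⟩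
    (+ n - + j) * ((N₁ - + j) * X) ≡⟨ reassoc′ (+ n - + j) (N₁ - + j) X ⟩
    (+ n - + j) * (N₁ - + j) * X   ∎

  C[n+1,j] : μ * X ≡ N₁ * J₁ * X
  C[n+1,j] = refl

  C[n+1,j+1] : μ * (suc n Cℤ suc j) ≡ N₁ * (N₁ - + j) * X
  C[n+1,j+1] = begin
    μ * (suc n Cℤ suc j)         ≡⟨ ℤ.*-assoc N₁ J₁ (suc n Cℤ suc j) ⟩
    N₁ * (J₁ * (suc n Cℤ suc j)) ≡⟨ cong (N₁ *_) (row-ratio (suc n) j) ⟩
    N₁ * ((N₁ - + j) * X)        ≡⟨ reassoc′ N₁ (N₁ - + j) X ⟩
    N₁ * (N₁ - + j) * X          ∎

  C[n+2,j+1] : μ * (suc (suc n) Cℤ suc j) ≡ N₁ * + suc (suc n) * X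
  C[n+2,j+1] = begin
    μ * (suc (suc n) Cℤ suc j)         ≡⟨ ℤ.*-assoc N₁ J₁ (suc (suc n) Cℤ suc j) ⟩
    N₁ * (J₁ * (suc (suc n) Cℤ suc j)) ≡⟨ cong (N₁ *_) (absorptionℤ (suc n) j) ⟩
    N₁ * (+ suc (suc n) * X)           ≡⟨ reassoc′ N₁ (+ suc (suc n)) X ⟩
    N₁ * + suc (suc n) * X             ∎

factorial-formula : ∀ {n k} → k ≤ n → k ! ℕ.* (n ℕ.∸ k) ! ℕ.* (n C k) ≡ n !
factorial-formula {n} {k} k≤n =
  trans (cong (k ! ℕ.* (n ℕ.∸ k) ! ℕ.*_) (nCk≡n!/k![n-k]! k≤n)) (m*[n/m]≡n (k![n∸k]!∣n! k≤n))
  where instance _ = ℕ.m*n≢0 (k !) ((n ℕ.∸ k) !) {{ℕ._!≢0 k}} {{ℕ._!≢0 (n ℕ.∸ k)}}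

∑≡sum : ∀ n (f : ℕ → ℤ) → ∑ n f ≡ Vec.foldr _+_ 0ℤ (λ (i : Fin n) → f (toℕ i))
∑≡sum zero    f = refl
∑≡sum (suc n) f = trans (∑-head n f) (cong (λ s → f 0 + s) (∑≡sum n (f ∘ suc)))

binomial-theorem : ∀ k x y → (x + y) ^ k ≡ ∑ (suc k) (λ j → (k Cℤ j) * (x ^ j * y ^ (k ℕ.∸ j)))
binomial-theorem k x y = begin
  (x + y) ^ k ≡⟨ ^-agrees (x + y) k ⟩
  (x + y) ^ₛ k ≡⟨ binomial-expansion k x y ⟩
  Vec.foldr _+_ 0ℤ (λ (i : Fin (suc k)) → (k C toℕ i) ⊛ (x ^ₛ toℕ i * y ^ₛ (k ℕ.∸ toℕ i)))
    ≡⟨ sym (∑≡sum (suc k) _) ⟩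
  ∑ (suc k) (λ j → (k C j) ⊛ (x ^ₛ j * y ^ₛ (k ℕ.∸ j)))
    ≡⟨ ∑-cong (suc k) (λ {j} _ → trans (×-agrees (k C j) _)
         (sym (cong₂ (λ a b → (k Cℤ j) * (a * b)) (^-agrees x j) (^-agrees y (k ℕ.∸ j))))) ⟩
  ∑ (suc k) (λ j → (k Cℤ j) * (x ^ j * y ^ (k ℕ.∸ j))) ∎
  where
  open ≡-Reasoning
  open Exp ℤ.+-*-semiring using () renaming (_^_ to _^ₛ_)
  open RawMonoid +-0-rawMonoid using () renaming (_×_ to _⊛_)
  ^-agrees : ∀ x n → x ^ n ≡ x ^ₛ n
  ^-agrees x zero    = refl
  ^-agrees x (suc n) = cong (x *_) (^-agrees x n)
  ×-agrees : ∀ m x → m ⊛ x ≡ + m * x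
  ×-agrees zero    x = sym (ℤ.*-zeroˡ x)
  ×-agrees (suc m) x = trans (cong (λ s → x + s) (×-agrees m x)) (one-more (+ m) x)
    where
    one-more : ∀ m x → x + m * x ≡ (+ 1 + m) * x
    one-more = solve-∀

sum-concatMap : ∀ {A B : Set} (g : B → ℕ) (h : A → List B) (xs : List A) →
  sum (map g (concatMap h xs)) ≡ sum (map (λ x → sum (map g (h x))) xs)
sum-concatMap g h []       = refl
sum-concatMap g h (x ∷ xs) = begin
  sum (map g (h x ++ concatMap h xs))               ≡⟨ cong sum (map-++ g (h x) (concatMap h xs)) ⟩
  sum (map g (h x) ++ map g (concatMap h xs))       ≡⟨ sum-++ (map g (h x)) _ ⟩
  sum (map g (h x)) ℕ.+ sum (map g (concatMap h xs))          ≡⟨ cong (sum (map g (h x)) ℕ.+_) (sum-concatMap g h xs) ⟩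
  sum (map g (h x)) ℕ.+ sum (map (λ x → sum (map g (h x))) xs) ∎
  where open ≡-Reasoning

sum-map-*ˡ : ∀ {A : Set} c (f : A → ℕ) (xs : List A) → sum (map (λ x → c ℕ.* f x) xs) ≡ c ℕ.* sum (map f xs)
sum-map-*ˡ c f []       = sym (ℕ.*-zeroʳ c)
sum-map-*ˡ c f (x ∷ xs) = trans (cong (c ℕ.* f x ℕ.+_) (sum-map-*ˡ c f xs)) (sym (ℕ.*-distribˡ-+ c (f x) _))

sum-applyUpTo : ∀ n (f : ℕ → ℕ) (g : ℕ → ℕ) → + sum (map f (applyUpTo g n)) ≡ ∑ n (λ j → + f (g j))
sum-applyUpTo zero    f g = refl
sum-applyUpTo (suc n) f g = begin
  + (f (g 0) ℕ.+ sum (map f (applyUpTo (g ∘ suc) n))) ≡⟨ ℤ.pos-+ (f (g 0)) _ ⟩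
  + f (g 0) + + sum (map f (applyUpTo (g ∘ suc) n))   ≡⟨ cong (λ s → + f (g 0) + s) (sum-applyUpTo n f (g ∘ suc)) ⟩
  + f (g 0) + ∑ n (λ j → + f (g (suc j)))              ≡⟨ sym (∑-head n (λ j → + f (g j))) ⟩
  ∑ (suc n) (λ j → + f (g j))                          ∎
  where open ≡-Reasoning

pos-^ : ∀ a r → + (a ℕ.^ r) ≡ (+ a) ^ r
pos-^ a zero    = refl
pos-^ a (suc r) = trans (ℤ.pos-* a (a ℕ.^ r)) (cong (+ a *_) (pos-^ a r))

-- C(k,j₁)·C(k-j₁,j₂)⋯: the multinomial coefficient as a product of binomials.
binomialProduct : ∀ {m} → ℕ → Vec ℕ m → ℕ
binomialProduct k []      = 1
binomialProduct k (j ∷ v) = (k C j) ℕ.* binomialProduct (k ∸ j) v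

Splits : ∀ {m} → ℕ → Vec ℕ m → Set
Splits k v = factProd v ℕ.* binomialProduct k v ≡ k !

splits-∷ : ∀ {m k j} (w : Vec ℕ m) → j ≤ k → Splits (k ∸ j) w → Splits k (j ∷ w)
splits-∷ {k = k} {j} w j≤k splits = begin
  j ! ℕ.* factProd w ℕ.* ((k C j) ℕ.* binomialProduct (k ∸ j) w)  ≡⟨ regroup (j !) (factProd w) (k C j) _ ⟩
  j ! ℕ.* (factProd w ℕ.* binomialProduct (k ∸ j) w) ℕ.* (k C j)  ≡⟨ cong (λ x → j ! ℕ.* x ℕ.* (k C j)) splits ⟩
  j ! ℕ.* (k ∸ j) ! ℕ.* (k C j)                                   ≡⟨ factorial-formula j≤k ⟩
  k !                                                            ∎
  where
  open ≡-Reasoning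
  regroup : ∀ a b c d → a ℕ.* b ℕ.* (c ℕ.* d) ≡ a ℕ.* (b ℕ.* d) ℕ.* c
  regroup = ℕ-Solver.solve-∀

compositions-split : ∀ m k → All (Splits k) (compositions m k)
compositions-split zero    zero    = refl ∷ []
compositions-split zero    (suc k) = []
compositions-split (suc m) k = concat⁺ (map⁺ (applyUpTo⁺₁ (λ j → j) (suc k) (λ {j} j<1+k →
  map⁺ (All.map (λ {w} → splits-∷ w (ℕ.≤-pred j<1+k)) (compositions-split m (k ∸ j))))))

multinomial≡binomialProduct : ∀ {m} k (v : Vec ℕ m) → Splits k v → multinomial k v ≡ binomialProduct k v
multinomial≡binomialProduct k v splits = trans
  (cong (λ x → (x / factProd v) {{factProd≢0 v}}) (trans (sym splits) (ℕ.*-comm (factProd v) _)))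
  (m*n/n≡m (binomialProduct k v) (factProd v) {{factProd≢0 v}})

M-as-binomialProducts : ∀ m k r → M m k r ≡ sum (map (λ v → binomialProduct k v ℕ.^ r) (compositions m k))
M-as-binomialProducts m k r = cong sum (map-cong-local
  (All.map (λ {v} splits → cong (ℕ._^ r) (multinomial≡binomialProduct k v splits)) (compositions-split m k)))

M-recursion : ∀ m k r → + M (suc m) k r ≡ ∑ (suc k) (λ j → (k Cℤ j) ^ r * + M m (k ∸ j) r)
M-recursion m k r = begin
  + M (suc m) k r
    ≡⟨ cong +_ (M-as-binomialProducts (suc m) k r) ⟩
  + sum (map power (concatMap parts (upTo (suc k))))
    ≡⟨ cong +_ (sum-concatMap power parts (upTo (suc k))) ⟩
  + sum (map (λ j → sum (map power (parts j))) (upTo (suc k)))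
    ≡⟨ cong +_ (cong sum (map-cong first-part (upTo (suc k)))) ⟩
  + sum (map (λ j → (k C j) ℕ.^ r ℕ.* M m (k ∸ j) r) (upTo (suc k)))
    ≡⟨ sum-applyUpTo (suc k) _ (λ j → j) ⟩
  ∑ (suc k) (λ j → + ((k C j) ℕ.^ r ℕ.* M m (k ∸ j) r))
    ≡⟨ ∑-cong (suc k) (λ {j} _ → trans (ℤ.pos-* ((k C j) ℕ.^ r) _) (cong (_* + M m (k ∸ j) r) (pos-^ (k C j) r))) ⟩
  ∑ (suc k) (λ j → (k Cℤ j) ^ r * + M m (k ∸ j) r) ∎
  where
  open ≡-Reasoning
  power : Vec ℕ (suc m) → ℕ
  power v = binomialProduct k v ℕ.^ r
  parts : ℕ → List (Vec ℕ (suc m))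
  parts j = map (j ∷_) (compositions m (k ∸ j))
  power-of-product : ∀ a b r → (a ℕ.* b) ℕ.^ r ≡ a ℕ.^ r ℕ.* b ℕ.^ r
  power-of-product a b zero    = refl
  power-of-product a b (suc r) =
    trans (cong (a ℕ.* b ℕ.*_) (power-of-product a b r)) (interchange a b (a ℕ.^ r) (b ℕ.^ r))
    where
    interchange : ∀ a b c d → a ℕ.* b ℕ.* (c ℕ.* d) ≡ a ℕ.* c ℕ.* (b ℕ.* d)
    interchange = ℕ-Solver.solve-∀
  first-part : ∀ j → sum (map power (parts j)) ≡ (k C j) ℕ.^ r ℕ.* M m (k ∸ j) r
  first-part j = begin
    sum (map power (parts j))
      ≡⟨ cong sum (sym (map-∘ (compositions m (k ∸ j)))) ⟩
    sum (map (λ w → ((k C j) ℕ.* binomialProduct (k ∸ j) w) ℕ.^ r) (compositions m (k ∸ j)))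
      ≡⟨ cong sum (map-cong (λ w → power-of-product (k C j) _ r) (compositions m (k ∸ j))) ⟩
    sum (map (λ w → (k C j) ℕ.^ r ℕ.* binomialProduct (k ∸ j) w ℕ.^ r) (compositions m (k ∸ j)))
      ≡⟨ sum-map-*ˡ ((k C j) ℕ.^ r) _ (compositions m (k ∸ j)) ⟩
    (k C j) ℕ.^ r ℕ.* sum (map (λ w → binomialProduct (k ∸ j) w ℕ.^ r) (compositions m (k ∸ j)))
      ≡⟨ cong ((k C j) ℕ.^ r ℕ.*_) (sym (M-as-binomialProducts m (k ∸ j) r)) ⟩
    (k C j) ℕ.^ r ℕ.* M m (k ∸ j) r ∎

rowSum : (ℕ → ℕ → ℤ) → ℕ → ℤ
rowSum F n = ∑ (suc n) (F n)

powerSum : ℕ → ℕ → ℤ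
powerSum r = rowSum (λ n j → (n Cℤ j) ^ r)

M[0,0]≡1 : ∀ r → + M 0 0 r ≡ 1ℤ
M[0,0]≡1 r = cong +_ (trans (ℕ.+-identityʳ (1 ℕ.^ r)) (ℕ.^-zeroˡ r))

-- M_{1,k} = 1: the only composition of k into one part is (k).
M[1,k]≡1 : ∀ k r → + M 1 k r ≡ 1ℤ
M[1,k]≡1 k r = begin
  + M 1 k r                                               ≡⟨ M-recursion 0 k r ⟩
  ∑ k term + (k Cℤ k) ^ r * + M 0 (k ∸ k) r              ≡⟨ cong₂ _+_ (∑-zero k term below-diagonal) diagonal ⟩
  0ℤ + 1ℤ                                                 ∎
  where
  open ≡-Reasoning
  term : ℕ → ℤ
  term j = (k Cℤ j) ^ r * + M 0 (k ∸ j) r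
  below-diagonal : ∀ {j} → j < k → term j ≡ 0ℤ
  below-diagonal {j} j<k = trans (cong (λ i → (k Cℤ j) ^ r * + M 0 i r) (ℕ.+-∸-assoc 1 j<k)) (ℤ.*-zeroʳ ((k Cℤ j) ^ r))
  diagonal : (k Cℤ k) ^ r * + M 0 (k ∸ k) r ≡ 1ℤ
  diagonal = begin
    (k Cℤ k) ^ r * + M 0 (k ∸ k) r ≡⟨ cong₂ (λ c i → (+ c) ^ r * + M 0 i r) (nCn≡1 k) (ℕ.n∸n≡0 k) ⟩
    1ℤ ^ r * + M 0 0 r             ≡⟨ cong₂ _*_ (ℤ.^-zeroˡ r) (M[0,0]≡1 r) ⟩
    1ℤ                             ∎

M[2,k]≡powerSum : ∀ k r → + M 2 k r ≡ powerSum r k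
M[2,k]≡powerSum k r = trans (M-recursion 1 k r)
  (∑-cong (suc k) (λ {j} _ → trans (cong ((k Cℤ j) ^ r *_) (M[1,k]≡1 (k ∸ j) r)) (ℤ.*-identityʳ _)))

M-exponent-0-step : ∀ m k → + M (suc m) (suc k) 0 ≡ + M m (suc k) 0 + + M (suc m) k 0
M-exponent-0-step m k = begin
  + M (suc m) (suc k) 0                                       ≡⟨ M-recursion m (suc k) 0 ⟩
  ∑ (suc (suc k)) (λ j → 1ℤ * + M m (suc k ∸ j) 0)           ≡⟨ ∑-head (suc k) _ ⟩
  1ℤ * + M m (suc k) 0 + ∑ (suc k) (λ j → 1ℤ * + M m (k ∸ j) 0)
    ≡⟨ cong₂ _+_ (ℤ.*-identityˡ (+ M m (suc k) 0)) (sym (M-recursion m k 0)) ⟩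
  + M m (suc k) 0 + + M (suc m) k 0                           ∎
  where open ≡-Reasoning

M-exponent-0 : ∀ m k → + M (suc m) k 0 ≡ (k ℕ.+ m) Cℤ m
M-exponent-0 zero    k       = M[1,k]≡1 k 0
M-exponent-0 (suc m) zero    = begin
  + M (suc (suc m)) 0 0  ≡⟨ M-recursion (suc m) 0 0 ⟩
  0ℤ + 1ℤ * + M (suc m) 0 0 ≡⟨ trans (ℤ.+-identityˡ (1ℤ * + M (suc m) 0 0)) (ℤ.*-identityˡ (+ M (suc m) 0 0)) ⟩
  + M (suc m) 0 0        ≡⟨ M-exponent-0 m 0 ⟩
  + (m C m)              ≡⟨ cong +_ (trans (nCn≡1 m) (sym (nCn≡1 (suc m)))) ⟩
  suc m Cℤ suc m         ∎
  where open ≡-Reasoning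
M-exponent-0 (suc m) (suc k) = begin
  + M (suc (suc m)) (suc k) 0
    ≡⟨ M-exponent-0-step (suc m) k ⟩
  + M (suc m) (suc k) 0 + + M (suc (suc m)) k 0
    ≡⟨ cong₂ _+_ (M-exponent-0 m (suc k)) (M-exponent-0 (suc m) k) ⟩
  (suc k ℕ.+ m) Cℤ m + (k ℕ.+ suc m) Cℤ suc m
    ≡⟨ cong (λ i → (i Cℤ m) + ((k ℕ.+ suc m) Cℤ suc m)) (sym (ℕ.+-suc k m)) ⟩
  (k ℕ.+ suc m) Cℤ m + (k ℕ.+ suc m) Cℤ suc m
    ≡⟨ sym (trans (cong +_ (pascal (k ℕ.+ suc m) m)) (ℤ.pos-+ ((k ℕ.+ suc m) C m) ((k ℕ.+ suc m) C suc m))) ⟩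
  (suc k ℕ.+ suc m) Cℤ suc m ∎
  where open ≡-Reasoning

-- For r = 1 the binomial theorem gives M_{m,k} = m^k.
M-exponent-1 : ∀ m k → + M m k 1 ≡ (+ m) ^ k
M-exponent-1 zero    zero    = M[0,0]≡1 1
M-exponent-1 zero    (suc k) = sym (ℤ.*-zeroˡ ((+ 0) ^ k))
M-exponent-1 (suc m) k       = begin
  + M (suc m) k 1                                           ≡⟨ M-recursion m k 1 ⟩
  ∑ (suc k) (λ j → (k Cℤ j) ^ 1 * + M m (k ∸ j) 1)
    ≡⟨ ∑-cong (suc k) (λ {j} _ → cong₂ _*_ (ℤ.^-identityʳ (k Cℤ j))
                        (trans (M-exponent-1 m (k ∸ j)) (sym (trans (cong (_* (+ m) ^ (k ∸ j)) (ℤ.^-zeroˡ j)) (ℤ.*-identityˡ _))))) ⟩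
  ∑ (suc k) (λ j → (k Cℤ j) * (1ℤ ^ j * (+ m) ^ (k ∸ j)))   ≡⟨ sym (binomial-theorem k 1ℤ (+ m)) ⟩
  (+ suc m) ^ k                                              ∎
  where open ≡-Reasoning

trinomialSquares : ℕ → ℤ
trinomialSquares = rowSum (λ n j → (n Cℤ j) ^ 2 * powerSum 2 j)

-- Reversing the sum in the recursion M_{3,k} = Σⱼ C(k,j)² M_{2,k-j}, by symmetry of C(k,·).
M[3,k,2]≡trinomialSquares : ∀ k → + M 3 k 2 ≡ trinomialSquares k
M[3,k,2]≡trinomialSquares k = begin
  + M 3 k 2                                                 ≡⟨ M-recursion 2 k 2 ⟩
  ∑ (suc k) (λ j → (k Cℤ j) ^ 2 * + M 2 (k ∸ j) 2)          ≡⟨ ∑-reverse (suc k) _ ⟩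
  ∑ (suc k) (λ j → (k Cℤ (k ∸ j)) ^ 2 * + M 2 (k ∸ (k ∸ j)) 2)
    ≡⟨ ∑-cong (suc k) (λ {j} j<1+k → reflect (ℕ.≤-pred j<1+k)) ⟩
  trinomialSquares k                                        ∎
  where
  open ≡-Reasoning
  reflect : ∀ {j} → j ≤ k → (k Cℤ (k ∸ j)) ^ 2 * + M 2 (k ∸ (k ∸ j)) 2 ≡ (k Cℤ j) ^ 2 * powerSum 2 j
  reflect {j} j≤k = cong₂ (λ c i → (+ c) ^ 2 * i) (sym (nCk≡nC[n∸k] j≤k))
                                                  (trans (cong (λ i → + M 2 i 2) (ℕ.m∸[m∸n]≡n j≤k)) (M[2,k]≡powerSum j 2))

^-distribʳ-* : ∀ a b d → (a * b) ^ d ≡ a ^ d * b ^ d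
^-distribʳ-* a b zero    = refl
^-distribʳ-* a b (suc d) = trans (cong (a * b *_) (^-distribʳ-* a b d)) (interchange a b (a ^ d) (b ^ d))
  where
  interchange : ∀ a b c e → a * b * (c * e) ≡ a * c * (b * e)
  interchange = solve-∀

-- A monomial c·xᵈ·y of a form that is homogeneous in the values x and in the
-- weights y, together with "ratios" p and q: polynomials such that μ·x = p·X
-- and ν·y = q·Y for common bases X, Y and nonzero scalings μ, ν.
data Monomial : Set where
  monomial : (c x y p q : ℤ) → Monomial

evaluate : ℕ → List Monomial → ℤ
evaluate d []                          = 0ℤ
evaluate d (monomial c x y _ _ ∷ ts) = c * x ^ d * y + evaluate d ts

predict : ℕ → List Monomial → ℤ
predict d []                          = 0ℤ
predict d (monomial c _ _ p q ∷ ts) = c * p ^ d * q + predict d ts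

Predicts : ℤ → ℤ → ℤ → ℤ → Monomial → Set
Predicts μ X ν Y (monomial _ x y p q) = μ * x ≡ p * X × ν * y ≡ q * Y

evaluate-scaled : ∀ d μ X ν Y ts → All (Predicts μ X ν Y) ts →
  μ ^ d * ν * evaluate d ts ≡ X ^ d * Y * predict d ts
evaluate-scaled d μ X ν Y []                          []                =
  trans (ℤ.*-zeroʳ (μ ^ d * ν)) (sym (ℤ.*-zeroʳ (X ^ d * Y)))
evaluate-scaled d μ X ν Y (monomial c x y p q ∷ ts) ((μx , νy) ∷ rest) = begin
  μ ^ d * ν * (c * x ^ d * y + evaluate d ts)
    ≡⟨ distribute (μ ^ d) ν c (x ^ d) y (evaluate d ts) ⟩
  c * (μ ^ d * x ^ d) * (ν * y) + μ ^ d * ν * evaluate d ts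
    ≡⟨ cong₂ (λ a b → c * a * b + μ ^ d * ν * evaluate d ts)
             (trans (sym (^-distribʳ-* μ x d)) (trans (cong (_^ d) μx) (^-distribʳ-* p X d))) νy ⟩
  c * (p ^ d * X ^ d) * (q * Y) + μ ^ d * ν * evaluate d ts
    ≡⟨ cong (λ E → c * (p ^ d * X ^ d) * (q * Y) + E) (evaluate-scaled d μ X ν Y ts rest) ⟩
  c * (p ^ d * X ^ d) * (q * Y) + X ^ d * Y * predict d ts
    ≡⟨ collect (X ^ d) Y c (p ^ d) q (predict d ts) ⟩
  X ^ d * Y * (c * p ^ d * q + predict d ts) ∎
  where
  open ≡-Reasoning
  distribute : ∀ μᵈ ν c xᵈ y E → μᵈ * ν * (c * xᵈ * y + E) ≡ c * (μᵈ * xᵈ) * (ν * y) + μᵈ * ν * E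
  distribute = solve-∀
  collect : ∀ Xᵈ Y c pᵈ q P → c * (pᵈ * Xᵈ) * (q * Y) + Xᵈ * Y * P ≡ Xᵈ * Y * (c * pᵈ * q + P)
  collect = solve-∀

evaluate-vanishes : ∀ d μ X ν Y ts → μ ≢ 0ℤ → ν ≢ 0ℤ → All (Predicts μ X ν Y) ts →
  predict d ts ≡ 0ℤ → evaluate d ts ≡ 0ℤ
evaluate-vanishes d μ X ν Y ts μ≢0 ν≢0 predicted zero-prediction
  with ℤ.i*j≡0⇒i≡0∨j≡0 (μ ^ d * ν) scaled-zero
  where
  scaled-zero : μ ^ d * ν * evaluate d ts ≡ 0ℤ
  scaled-zero = trans (evaluate-scaled d μ X ν Y ts predicted)
                      (trans (cong (X ^ d * Y *_) zero-prediction) (ℤ.*-zeroʳ (X ^ d * Y)))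
... | inj₂ vanishes = vanishes
... | inj₁ scale≡0 with ℤ.i*j≡0⇒i≡0∨j≡0 (μ ^ d) scale≡0
...   | inj₁ μᵈ≡0 = ⊥-elim (μ≢0 (ℤ.i^n≡0⇒i≡0 μ d μᵈ≡0))
...   | inj₂ ν≡0  = ⊥-elim (ν≢0 ν≡0)

shiftCombination : (a b c : ℕ → ℤ) (F : ℕ → ℕ → ℤ) → ℕ → ℕ → ℤ
shiftCombination a b c F n j = a n * F (suc (suc n)) j + b n * F (suc n) j + c n * F n j

creative-telescoping : ∀ (a b c : ℕ → ℤ) (F G : ℕ → ℕ → ℤ) →
  (∀ {n j} → n < j → F n j ≡ 0ℤ) →
  (∀ n → shiftCombination a b c F n 0 ≡ G n 0) →
  (∀ n j → shiftCombination a b c F n (suc j) ≡ G n (suc j) - G n j) →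
  (∀ n → G n (suc (suc n)) ≡ 0ℤ) →
  ∀ n → a n * rowSum F (suc (suc n)) + b n * rowSum F (suc n) + c n * rowSum F n ≡ 0ℤ
creative-telescoping a b c F G support base step end n = begin
  a n * rowSum F (suc (suc n)) + b n * rowSum F (suc n) + c n * rowSum F n
    ≡⟨ cong₂ (λ s t → a n * rowSum F (suc (suc n)) + b n * s + c n * t)
             (sym (∑-pad (suc (suc n)) 1 (F (suc n)) (support ∘ ℕ.≤-trans (ℕ.n<1+n _))))
             (sym (∑-pad (suc n) 2 (F n) (support ∘ ℕ.≤-trans (ℕ.n<1+n _)))) ⟩
  a n * ∑ N (F (suc (suc n))) + b n * ∑ N (F (suc n)) + c n * ∑ N (F n)
    ≡⟨ sym (linear N (a n) (b n) (c n) (F (suc (suc n))) (F (suc n)) (F n)) ⟩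
  ∑ N (shiftCombination a b c F n)
    ≡⟨ ∑-telescope₀ (suc (suc n)) (shiftCombination a b c F n) (G n) (base n) (step n) ⟩
  G n (suc (suc n))
    ≡⟨ end n ⟩
  0ℤ ∎
  where
  open ≡-Reasoning
  N : ℕ
  N = suc (suc (suc n))
  linear : ∀ N α β γ (f g h : ℕ → ℤ) →
    ∑ N (λ j → α * f j + β * g j + γ * h j) ≡ α * ∑ N f + β * ∑ N g + γ * ∑ N h
  linear N α β γ f g h = begin
    ∑ N (λ j → α * f j + β * g j + γ * h j)
      ≡⟨ ∑-+ N (λ j → α * f j + β * g j) (λ j → γ * h j) ⟩
    ∑ N (λ j → α * f j + β * g j) + ∑ N (λ j → γ * h j)
      ≡⟨ cong₂ _+_ (trans (∑-+ N (λ j → α * f j) (λ j → β * g j)) (cong₂ _+_ (∑-*ˡ N α f) (∑-*ˡ N β g))) (∑-*ˡ N γ h) ⟩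
    α * ∑ N f + β * ∑ N g + γ * ∑ N h ∎

by-homogeneity : ∀ {L ΔG} d μ X ν Y ts → μ ≢ 0ℤ → ν ≢ 0ℤ → All (Predicts μ X ν Y) ts →
  predict d ts ≡ 0ℤ → L - ΔG ≡ evaluate d ts → L ≡ ΔG
by-homogeneity {L} {ΔG} d μ X ν Y ts μ≢0 ν≢0 predicted zero-prediction rearranged =
  ℤ.i-j≡0⇒i≡j L ΔG (trans rearranged (evaluate-vanishes d μ X ν Y ts μ≢0 ν≢0 predicted zero-prediction))

C-support : ∀ {n j} → n < j → n Cℤ j ≡ 0ℤ
C-support n<j = cong +_ (k>n⇒nCk≡0 n<j)

-- s(n) = Σⱼ C(n,j)² satisfies (n+1)·s(n+1) = 2(2n+1)·s(n), with
-- certificate G(n,j) = (2j - 3n - 1)·C(n,j)².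
module SquareSums where
  squareKernel : ℕ → ℕ → ℤ
  squareKernel n j = (n Cℤ j) ^ 2

  a b c : ℕ → ℤ
  a n = 0ℤ
  b n = + suc n
  c n = - (+ 2 * (+ 2 * + n + 1ℤ))

  g : ℕ → ℕ → ℤ
  g n j = + 2 * + j - + 3 * + n - 1ℤ

  G : ℕ → ℕ → ℤ
  G n j = squareKernel n j * g n j

  base : ∀ n → shiftCombination a b c squareKernel n 0 ≡ G n 0
  base n = polynomial (+ n)
    where
    polynomial : ∀ N → let one = + 1 * (+ 1 * 1ℤ) in
      0ℤ * one + (+ 1 + N) * one + - (+ 2 * (+ 2 * N + 1ℤ)) * one ≡ one * (+ 2 * + 0 - + 3 * N - 1ℤ)
    polynomial = solve-∀

  -- At j + 1 it follows by homogeneity from the window around C(n+1,j).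
  step : ∀ n j → shiftCombination a b c squareKernel n (suc j) ≡ G n (suc j) - G n j
  step n j = by-homogeneity 2 μ X 1ℤ 1ℤ monomials (λ ()) (λ ())
    ((C[n+1,j+1] , refl) ∷ (C[n,j+1] , refl) ∷ (C[n,j] , refl) ∷ [])
    (polynomial (+ n) (+ j))
    (rearrange (+ n) (+ j) (suc (suc n) Cℤ suc j) (suc n Cℤ suc j) (n Cℤ suc j) (n Cℤ j))
    where
    open Window n j
    monomials : List Monomial
    monomials = monomial (b n)               (suc n Cℤ suc j) 1ℤ (N₁ * (N₁ - + j))        1ℤ
              ∷ monomial (c n - g n (suc j)) (n Cℤ suc j)     1ℤ ((+ n - + j) * (N₁ - + j)) 1ℤ
              ∷ monomial (g n j)             (n Cℤ j)         1ℤ (J₁ * (N₁ - + j))        1ℤ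
              ∷ []
    rearrange : ∀ N J z x₁ x₂ x₃ →
      let sq x = x * (x * 1ℤ)
          c  = - (+ 2 * (+ 2 * N + 1ℤ))
          g₀ = + 2 * J - + 3 * N - 1ℤ
          g₁ = + 2 * (+ 1 + J) - + 3 * N - 1ℤ
      in 0ℤ * sq z + (+ 1 + N) * sq x₁ + c * sq x₂ - (sq x₂ * g₁ - sq x₃ * g₀)
         ≡ (+ 1 + N) * sq x₁ * 1ℤ + ((c - g₁) * sq x₂ * 1ℤ + (g₀ * sq x₃ * 1ℤ + 0ℤ))
    rearrange = solve-∀
    polynomial : ∀ N J →
      let sq x = x * (x * 1ℤ)
          N₁ = + 1 + N
          J₁ = + 1 + J
          c  = - (+ 2 * (+ 2 * N + 1ℤ))
          g₀ = + 2 * J - + 3 * N - 1ℤ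
          g₁ = + 2 * (+ 1 + J) - + 3 * N - 1ℤ
      in N₁ * sq (N₁ * (N₁ - J)) * 1ℤ + ((c - g₁) * sq ((N - J) * (N₁ - J)) * 1ℤ + (g₀ * sq (J₁ * (N₁ - J)) * 1ℤ + 0ℤ))
         ≡ 0ℤ
    polynomial = solve-∀

  end : ∀ n → G n (suc (suc n)) ≡ 0ℤ
  end n = cong (λ x → x ^ 2 * g n (suc (suc n))) (C-support (ℕ.m<n⇒m<1+n (ℕ.n<1+n n)))

  recurrence : ∀ n → + suc n * powerSum 2 (suc n) ≡ + 2 * (+ 2 * + n + 1ℤ) * powerSum 2 n
  recurrence n = ℤ.i-j≡0⇒i≡j _ _ (trans (shape (powerSum 2 (suc (suc n))) (powerSum 2 (suc n)) (powerSum 2 n) (+ n))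
    (creative-telescoping a b c squareKernel G (λ n<j → cong (_^ 2) (C-support n<j)) base step end n))
    where
    shape : ∀ s₂ s₁ s₀ N → (+ 1 + N) * s₁ - + 2 * (+ 2 * N + 1ℤ) * s₀
                          ≡ 0ℤ * s₂ + (+ 1 + N) * s₁ + - (+ 2 * (+ 2 * N + 1ℤ)) * s₀
    shape = solve-∀

-- The Franel numbers f(n) = Σⱼ C(n,j)³ satisfy
-- (n+2)²f(n+2) = (7n²+21n+16)f(n+1) + 8(n+1)²f(n), with certificate
-- G(n,j) = C(n+1,j)³·P(n,j) for the cubic P below; the operator carries an
-- extra factor n+1, cancelled at the end.
module FranelNumbers where
  cubeKernel : ℕ → ℕ → ℤ
  cubeKernel n j = (n Cℤ j) ^ 3

  a b c : ℕ → ℤ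
  a n = + suc n * (+ 2 + + n) * (+ 2 + + n)
  b n = - (+ suc n * (+ 7 * + n * + n + + 21 * + n + + 16))
  c n = - (+ 8 * + suc n * + suc n * + suc n)

  P : ℤ → ℤ → ℤ
  P n j = - + 20 + + 30 * j - + 18 * j * j + + 4 * j * j * j - + 53 * n + + 57 * n * j
          - + 18 * n * j * j - + 47 * n * n + + 27 * n * n * j - + 14 * n * n * n

  G : ℕ → ℕ → ℤ
  G n j = cubeKernel (suc n) j * P (+ n) (+ j)

  base : ∀ n → shiftCombination a b c cubeKernel n 0 ≡ G n 0
  base n = polynomial (+ n)
    where
    polynomial : ∀ N → let one = + 1 * (+ 1 * (+ 1 * 1ℤ))
                           P n j = - + 20 + + 30 * j - + 18 * j * j + + 4 * j * j * j - + 53 * n + + 57 * n * j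
                                   - + 18 * n * j * j - + 47 * n * n + + 27 * n * n * j - + 14 * n * n * n in
      (+ 1 + N) * (+ 2 + N) * (+ 2 + N) * one + - ((+ 1 + N) * (+ 7 * N * N + + 21 * N + + 16)) * one
        + - (+ 8 * (+ 1 + N) * (+ 1 + N) * (+ 1 + N)) * one
      ≡ one * P N (+ 0)
    polynomial = solve-∀

  step : ∀ n j → shiftCombination a b c cubeKernel n (suc j) ≡ G n (suc j) - G n j
  step n j = by-homogeneity 3 μ X 1ℤ 1ℤ monomials (λ ()) (λ ())
    ((C[n+2,j+1] , refl) ∷ (C[n+1,j+1] , refl) ∷ (C[n,j+1] , refl) ∷ (C[n+1,j] , refl) ∷ [])
    (polynomial (+ n) (+ j))
    (rearrange (a n) (b n) (c n) (P (+ n) (+ suc j)) (P (+ n) (+ j))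
               (suc (suc n) Cℤ suc j) (suc n Cℤ suc j) (n Cℤ suc j) X)
    where
    open Window n j
    monomials : List Monomial
    monomials = monomial (a n)                     (suc (suc n) Cℤ suc j) 1ℤ (N₁ * + suc (suc n))     1ℤ
              ∷ monomial (b n - P (+ n) (+ suc j)) (suc n Cℤ suc j)       1ℤ (N₁ * (N₁ - + j))        1ℤ
              ∷ monomial (c n)                     (n Cℤ suc j)           1ℤ ((+ n - + j) * (N₁ - + j)) 1ℤ
              ∷ monomial (P (+ n) (+ j))           X                      1ℤ (N₁ * J₁)                1ℤ
              ∷ []
    rearrange : ∀ a b c P₁ P₀ x₂ x₁ x₀ y →
      let cube x = x * (x * (x * 1ℤ)) in
      a * cube x₂ + b * cube x₁ + c * cube x₀ - (cube x₁ * P₁ - cube y * P₀)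
      ≡ a * cube x₂ * 1ℤ + ((b - P₁) * cube x₁ * 1ℤ + (c * cube x₀ * 1ℤ + (P₀ * cube y * 1ℤ + 0ℤ)))
    rearrange = solve-∀
    polynomial : ∀ N J →
      let cube x = x * (x * (x * 1ℤ))
          N₁ = + 1 + N
          J₁ = + 1 + J
          P n j = - + 20 + + 30 * j - + 18 * j * j + + 4 * j * j * j - + 53 * n + + 57 * n * j
                  - + 18 * n * j * j - + 47 * n * n + + 27 * n * n * j - + 14 * n * n * n
      in N₁ * (+ 2 + N) * (+ 2 + N) * cube (N₁ * (+ 1 + N₁)) * 1ℤ
         + ((- (N₁ * (+ 7 * N * N + + 21 * N + + 16)) - P N J₁) * cube (N₁ * (N₁ - J)) * 1ℤ
         + (- (+ 8 * N₁ * N₁ * N₁) * cube ((N - J) * (N₁ - J)) * 1ℤ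
         + (P N J * cube (N₁ * J₁) * 1ℤ + 0ℤ)))
         ≡ 0ℤ
    polynomial = solve-∀

  end : ∀ n → G n (suc (suc n)) ≡ 0ℤ
  end n = cong (λ x → x ^ 3 * P (+ n) (+ suc (suc n))) (C-support (ℕ.n<1+n (suc n)))

  recurrence : ∀ n → (+ 2 + + n) * (+ 2 + + n) * powerSum 3 (suc (suc n))
                   ≡ (+ 7 * + n * + n + + 21 * + n + + 16) * powerSum 3 (suc n) + + 8 * + suc n * + suc n * powerSum 3 n
  recurrence n = ℤ.i-j≡0⇒i≡j _ _ (ℤ.*-cancelˡ-≡ (+ suc n) _ 0ℤ (trans
    (shape (powerSum 3 (suc (suc n))) (powerSum 3 (suc n)) (powerSum 3 n) (+ n))
    (trans (creative-telescoping a b c cubeKernel G (λ n<j → cong (_^ 3) (C-support n<j)) base step end n)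
           (sym (ℤ.*-zeroʳ (+ suc n))))))
    where
    shape : ∀ f₂ f₁ f₀ N →
      (+ 1 + N) * ((+ 2 + N) * (+ 2 + N) * f₂ - ((+ 7 * N * N + + 21 * N + + 16) * f₁ + + 8 * (+ 1 + N) * (+ 1 + N) * f₀))
      ≡ (+ 1 + N) * (+ 2 + N) * (+ 2 + N) * f₂ + - ((+ 1 + N) * (+ 7 * N * N + + 21 * N + + 16)) * f₁
        + - (+ 8 * (+ 1 + N) * (+ 1 + N) * (+ 1 + N)) * f₀
    shape = solve-∀

-- t(n) = Σⱼ C(n,j)²·s(j), where s(j) = Σᵢ C(j,i)², satisfies
-- (n+2)²t(n+2) - (10n²+30n+23)t(n+1) + 9(n+1)²t(n) = 0, with certificate
-- G(n,j) = -2(2j+1)(4n+5-3j)·C(n+1,j)²·s(j).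
module TrinomialSquareSums where
  s : ℕ → ℤ
  s = powerSum 2

  kernel : ℕ → ℕ → ℤ
  kernel n j = (n Cℤ j) ^ 2 * s j

  a b c : ℕ → ℤ
  a n = (+ 2 + + n) * (+ 2 + + n)
  b n = - (+ 10 * + n * + n + + 30 * + n + + 23)
  c n = + 9 * + suc n * + suc n

  g : ℤ → ℤ → ℤ
  g n j = - (+ 2 * (+ 2 * j + 1ℤ) * (+ 4 * n + + 5 - + 3 * j))

  G : ℕ → ℕ → ℤ
  G n j = (suc n Cℤ j) ^ 2 * s j * g (+ n) (+ j)

  base : ∀ n → shiftCombination a b c kernel n 0 ≡ G n 0
  base n = polynomial (+ n)
    where
    polynomial : ∀ N → let one = + 1 * (+ 1 * 1ℤ) * + 1 in
      (+ 2 + N) * (+ 2 + N) * one + - (+ 10 * N * N + + 30 * N + + 23) * one + + 9 * (+ 1 + N) * (+ 1 + N) * one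
      ≡ one * - (+ 2 * (+ 2 * + 0 + 1ℤ) * (+ 4 * N + + 5 - + 3 * + 0))
    polynomial = solve-∀

  step : ∀ n j → shiftCombination a b c kernel n (suc j) ≡ G n (suc j) - G n j
  step n j = by-homogeneity 2 μ X J₁ (s j) monomials (λ ()) (λ ())
    ((C[n+2,j+1] , s-step) ∷ (C[n+1,j+1] , s-step) ∷ (C[n,j+1] , s-step) ∷ (C[n+1,j] , refl) ∷ [])
    (polynomial (+ n) (+ j))
    (rearrange (a n) (b n) (c n) (g (+ n) (+ suc j)) (g (+ n) (+ j))
               (suc (suc n) Cℤ suc j) (suc n Cℤ suc j) (n Cℤ suc j) X (s (suc j)) (s j))
    where
    open Window n j
    ratio : ℤ
    ratio = + 2 * (+ 2 * + j + 1ℤ)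
    s-step : J₁ * s (suc j) ≡ ratio * s j
    s-step = SquareSums.recurrence j
    monomials : List Monomial
    monomials = monomial (a n)                     (suc (suc n) Cℤ suc j) (s (suc j)) (N₁ * + suc (suc n))     ratio
              ∷ monomial (b n - g (+ n) (+ suc j)) (suc n Cℤ suc j)       (s (suc j)) (N₁ * (N₁ - + j))        ratio
              ∷ monomial (c n)                     (n Cℤ suc j)           (s (suc j)) ((+ n - + j) * (N₁ - + j)) ratio
              ∷ monomial (g (+ n) (+ j))           X                      (s j)       (N₁ * J₁)                J₁
              ∷ []
    rearrange : ∀ a b c g₁ g₀ x₂ x₁ x₀ y s₁ s₀ →
      let sq x = x * (x * 1ℤ) in
      a * (sq x₂ * s₁) + b * (sq x₁ * s₁) + c * (sq x₀ * s₁) - (sq x₁ * s₁ * g₁ - sq y * s₀ * g₀)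
      ≡ a * sq x₂ * s₁ + ((b - g₁) * sq x₁ * s₁ + (c * sq x₀ * s₁ + (g₀ * sq y * s₀ + 0ℤ)))
    rearrange = solve-∀
    polynomial : ∀ N J →
      let sq x = x * (x * 1ℤ)
          N₁ = + 1 + N
          J₁ = + 1 + J
          ratio = + 2 * (+ 2 * J + 1ℤ)
          g n j = - (+ 2 * (+ 2 * j + 1ℤ) * (+ 4 * n + + 5 - + 3 * j))
      in (+ 2 + N) * (+ 2 + N) * sq (N₁ * (+ 1 + N₁)) * ratio
         + ((- (+ 10 * N * N + + 30 * N + + 23) - g N J₁) * sq (N₁ * (N₁ - J)) * ratio
         + (+ 9 * N₁ * N₁ * sq ((N - J) * (N₁ - J)) * ratio
         + (g N J * sq (N₁ * J₁) * J₁ + 0ℤ)))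
         ≡ 0ℤ
    polynomial = solve-∀

  end : ∀ n → G n (suc (suc n)) ≡ 0ℤ
  end n = cong (λ x → x ^ 2 * s (suc (suc n)) * g (+ n) (+ suc (suc n))) (C-support (ℕ.n<1+n (suc n)))

  recurrence : ∀ n → (+ 2 + + n) * (+ 2 + + n) * trinomialSquares (suc (suc n)) + + 9 * + suc n * + suc n * trinomialSquares n
                   ≡ (+ 10 * + n * + n + + 30 * + n + + 23) * trinomialSquares (suc n)
  recurrence n = ℤ.i-j≡0⇒i≡j _ _ (trans
    (shape (trinomialSquares (suc (suc n))) (trinomialSquares (suc n)) (trinomialSquares n) (+ n))
    (creative-telescoping a b c kernel G (λ {_} {j} n<j → cong (λ x → x ^ 2 * s j) (C-support n<j)) base step end n))
    where
    shape : ∀ t₂ t₁ t₀ N →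
      (+ 2 + N) * (+ 2 + N) * t₂ + + 9 * (+ 1 + N) * (+ 1 + N) * t₀ - (+ 10 * N * N + + 30 * N + + 23) * t₁
      ≡ (+ 2 + N) * (+ 2 + N) * t₂ + - (+ 10 * N * N + + 30 * N + + 23) * t₁ + + 9 * (+ 1 + N) * (+ 1 + N) * t₀
    shape = solve-∀

signPow-+ : ∀ a b → signPow (a ℕ.+ b) ≡ signPow a * signPow b
signPow-+ zero    b = sym (ℤ.*-identityˡ (signPow b))
signPow-+ (suc a) b = trans (cong -_ (signPow-+ a b)) (ℤ.neg-distribˡ-* (signPow a) (signPow b))

signPow-square : ∀ k → signPow k * signPow k ≡ 1ℤ
signPow-square zero    = refl
signPow-square (suc k) = trans (negated (signPow k)) (signPow-square k)
  where
  negated : ∀ e → - e * - e ≡ e * e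
  negated = solve-∀

signPow-even : ∀ k → signPow (2 ℕ.* k) ≡ 1ℤ
signPow-even k = trans (cong (λ e → signPow (k ℕ.+ e)) (ℕ.+-identityʳ k))
                       (trans (signPow-+ k k) (signPow-square k))

signPow-odd : ∀ k → signPow (3 ℕ.* k) ≡ signPow k
signPow-odd k = trans (signPow-+ k (2 ℕ.* k)) (trans (cong (signPow k *_) (signPow-even k)) (ℤ.*-identityʳ (signPow k)))

signPow-parity : ∀ r → (∀ k → signPow (r ℕ.* k) ≡ 1ℤ) ⊎ (∀ k → signPow (r ℕ.* k) ≡ signPow k)
signPow-parity zero    = inj₁ (λ k → refl)
signPow-parity (suc r) with signPow-parity r
... | inj₁ even = inj₂ (λ k → trans (signPow-+ k (r ℕ.* k)) (trans (cong (signPow k *_) (even k)) (ℤ.*-identityʳ (signPow k))))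
... | inj₂ odd  = inj₁ (λ k → trans (signPow-+ k (r ℕ.* k)) (trans (cong (signPow k *_) (odd k)) (signPow-square k)))

-- x² ≡ x (mod 2), by induction: (x+1)² - (x+1) = (x² - x) + 2x.
square-congruence : ∀ n → + 2 ∣ (+ n) ^ 2 - + n
square-congruence zero    = divides 0ℤ refl
square-congruence (suc n) = subst (+ 2 ∣_) (sym (expand (+ n)))
  (∣m∣n⇒∣m+n (square-congruence n) (divides (+ n) refl))
  where
  expand : ∀ x → let sq y = y * (y * 1ℤ) in sq (+ 1 + x) - (+ 1 + x) ≡ sq x - x + x * + 2
  expand = solve-∀

-- x³ ≡ x (mod 6), by induction: (x+1)³ - (x+1) = (x³ - x) + 3(x² - x) + 6x.
cube-congruence : ∀ n → + 6 ∣ (+ n) ^ 3 - + n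
cube-congruence zero    = divides 0ℤ refl
cube-congruence (suc n) = subst (+ 6 ∣_) (sym (expand (+ n)))
  (∣m∣n⇒∣m+n (∣m∣n⇒∣m+n (cube-congruence n) (tripled (square-congruence n))) (divides (+ n) refl))
  where
  expand : ∀ x → let sq y = y * (y * 1ℤ); cube y = y * sq y in
    cube (+ 1 + x) - (+ 1 + x) ≡ cube x - x + + 3 * (sq x - x) + x * + 6
  expand = solve-∀
  tripled : ∀ {y} → + 2 ∣ y → + 6 ∣ + 3 * y
  tripled {y} (divides q y≡2q) = divides q (trans (cong (+ 3 *_) y≡2q) (rearrange q))
    where
    rearrange : ∀ q → + 3 * (q * + 2) ≡ q * + 6
    rearrange = solve-∀

row-sum : ∀ k → ∑ (suc k) (λ j → k Cℤ j) ≡ (+ 2) ^ k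
row-sum k = sym (trans (binomial-theorem k 1ℤ 1ℤ)
  (∑-cong (suc k) (λ {j} _ → trans (cong₂ (λ u v → (k Cℤ j) * (u * v)) (ℤ.^-zeroˡ j) (ℤ.^-zeroˡ (k ℕ.∸ j)))
                                   (ℤ.*-identityʳ (k Cℤ j)))))

power-sum-congruence : ∀ r d → (∀ x → d ∣ (+ x) ^ r - + x) → ∀ k → d ∣ powerSum r k - (+ 2) ^ k
power-sum-congruence r d fermat k = subst (d ∣_)
  (trans (∑-- (suc k) (λ j → (k Cℤ j) ^ r) (λ j → k Cℤ j)) (cong (λ x → powerSum r k - x) (row-sum k)))
  (∑-∣ (suc k) d (λ j → (k Cℤ j) ^ r - k Cℤ j) (λ {j} _ → fermat (k C j)))

∣-congruent : ∀ {d a b} → d ∣ a - b → d ∣ b → d ∣ a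
∣-congruent {d} {a} {b} d∣a-b d∣b = subst (d ∣_) (restore a b) (∣m∣n⇒∣m+n d∣a-b d∣b)
  where
  restore : ∀ a b → a - b + b ≡ a
  restore = solve-∀

squareSum-even : ∀ n → + 2 ∣ powerSum 2 (suc n)
squareSum-even n = ∣-congruent (power-sum-congruence 2 (+ 2) square-congruence (suc n))
                               (divides ((+ 2) ^ n) (ℤ.*-comm (+ 2) ((+ 2) ^ n)))

-- For the Franel numbers, f(n+1) - 8f(n) ≡ 2^{n+1} - 8·2^n = -6·2^n ≡ 0 (mod 6).
franel-congruence : ∀ n → + 6 ∣ powerSum 3 (suc n) - + 8 * powerSum 3 n
franel-congruence n = subst (+ 6 ∣_) (regroup (powerSum 3 (suc n)) (powerSum 3 n) ((+ 2) ^ n))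
  (∣m∣n⇒∣m-n (∣m∣n⇒∣m-n (f≡2^k (suc n)) (∣n⇒∣m*n (+ 8) (f≡2^k n))) (divides ((+ 2) ^ n) (ℤ.*-comm (+ 6) _)))
  where
  f≡2^k : ∀ k → + 6 ∣ powerSum 3 k - (+ 2) ^ k
  f≡2^k = power-sum-congruence 3 (+ 6) cube-congruence
  regroup : ∀ f₁ f₀ p → f₁ - + 2 * p - + 8 * (f₀ - p) - + 6 * p ≡ f₁ - + 8 * f₀
  regroup = solve-∀

-- t(n) = Σⱼ C(n,j)²s(j) is odd: every term but the first (= s(0) = 1) is even.
trinomialSquares-odd : ∀ n → + 2 ∣ trinomialSquares n - 1ℤ
trinomialSquares-odd n = subst (λ x → + 2 ∣ x - 1ℤ) (sym (∑-head n (λ j → (n Cℤ j) ^ 2 * powerSum 2 j)))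
  (subst (+ 2 ∣_) (sym (drop-one _))
    (∑-∣ n (+ 2) _ (λ {j} _ → ∣n⇒∣m*n ((n Cℤ suc j) ^ 2) (squareSum-even j))))
  where
  drop-one : ∀ x → + 1 * (+ 1 * 1ℤ) * + 1 + x - 1ℤ ≡ x
  drop-one = solve-∀

recurrence-mod-3 : ∀ n → + 3 ∣ + suc (suc n) * (+ suc (suc n) * trinomialSquares (suc (suc n)) - + suc n * trinomialSquares (suc n))
recurrence-mod-3 n = divides ((+ 3 * + n * + n + + 9 * + n + + 7) * t₁ - + 3 * + suc n * + suc n * t₀) (begin
    + suc (suc n) * (+ suc (suc n) * t₂ - + suc n * t₁)
      ≡⟨ expand (+ n) t₂ t₁ t₀ ⟩
    (+ 2 + + n) * (+ 2 + + n) * t₂ + + 9 * + suc n * + suc n * t₀ - (+ 9 * + suc n * + suc n * t₀ + (+ 2 + + n) * + suc n * t₁)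
      ≡⟨ cong (_- (+ 9 * + suc n * + suc n * t₀ + (+ 2 + + n) * + suc n * t₁)) (TrinomialSquareSums.recurrence n) ⟩
    (+ 10 * + n * + n + + 30 * + n + + 23) * t₁ - (+ 9 * + suc n * + suc n * t₀ + (+ 2 + + n) * + suc n * t₁)
      ≡⟨ collect (+ n) t₁ t₀ ⟩
    ((+ 3 * + n * + n + + 9 * + n + + 7) * t₁ - + 3 * + suc n * + suc n * t₀) * + 3 ∎)
  where
  open ≡-Reasoning
  t₂ t₁ t₀ : ℤ
  t₂ = trinomialSquares (suc (suc n))
  t₁ = trinomialSquares (suc n)
  t₀ = trinomialSquares n
  expand : ∀ N t₂ t₁ t₀ →
    (+ 2 + N) * ((+ 2 + N) * t₂ - (+ 1 + N) * t₁)
    ≡ (+ 2 + N) * (+ 2 + N) * t₂ + + 9 * (+ 1 + N) * (+ 1 + N) * t₀ - (+ 9 * (+ 1 + N) * (+ 1 + N) * t₀ + (+ 2 + N) * (+ 1 + N) * t₁)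
  expand = solve-∀
  collect : ∀ N t₁ t₀ →
    (+ 10 * N * N + + 30 * N + + 23) * t₁ - (+ 9 * (+ 1 + N) * (+ 1 + N) * t₀ + (+ 2 + N) * (+ 1 + N) * t₁)
    ≡ ((+ 3 * N * N + + 9 * N + + 7) * t₁ - + 3 * (+ 1 + N) * (+ 1 + N) * t₀) * + 3
  collect = solve-∀

prime-divides-product : ∀ {p} → Prime p → ∀ a y → + p ∣ + a * y → p ℕ.∣ a ⊎ + p ∣ y
prime-divides-product {p} p-prime a y p∣ay =
  map₂ ∣ᵤ⇒∣ (euclidsLemma a ∣ y ∣ p-prime (subst (p ℕ.∣_) (ℤ.abs-* (+ a) y) (∣⇒∣ᵤ p∣ay)))

-- 3 divides n·t(n): by induction, since 3 ∣ (n+2)·[(n+2)t(n+2) - (n+1)t(n+1)].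
three-divides : ∀ n → + 3 ∣ + n * trinomialSquares n
three-divides zero          = divides 0ℤ refl
three-divides (suc zero)    = divides 1ℤ refl
three-divides (suc (suc n)) = by-cases (three-divides (suc n))
  (prime-divides-product (from-yes (prime? 3)) (suc (suc n)) _ (recurrence-mod-3 n))
  where
  by-cases : + 3 ∣ + suc n * trinomialSquares (suc n) →
             3 ℕ.∣ suc (suc n) ⊎ + 3 ∣ + suc (suc n) * trinomialSquares (suc (suc n)) - + suc n * trinomialSquares (suc n) →
             + 3 ∣ + suc (suc n) * trinomialSquares (suc (suc n))
  by-cases _    (inj₁ 3∣n+2) = ∣m⇒∣m*n (trinomialSquares (suc (suc n))) (∣ᵤ⇒∣ {+ 3} {+ suc (suc n)} 3∣n+2)
  by-cases 3∣IH (inj₂ 3∣Y)   = ∣-congruent 3∣Y 3∣IH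

summand : ℕ → ℕ → ℕ → ℤ
summand m r k = signPow (r ℕ.* k) * (((+ m + 1ℤ) * + k + + m) * + M m k r)

S-as-∑ : ∀ m r n → S m r n ≡ ∑ n (summand m r)
S-as-∑ m r n = trans (foldr-applyUpTo n _ (λ k → k)) (∑-cong n (λ {k} _ → cong (signPow (r ℕ.* k) *_) (cast k)))
  where
  cast : ∀ k → + (((m ℕ.+ 1) ℕ.* k ℕ.+ m) ℕ.* M m k r) ≡ ((+ m + 1ℤ) * + k + + m) * + M m k r
  cast k = begin
    + (((m ℕ.+ 1) ℕ.* k ℕ.+ m) ℕ.* M m k r)    ≡⟨ ℤ.pos-* ((m ℕ.+ 1) ℕ.* k ℕ.+ m) (M m k r) ⟩
    + ((m ℕ.+ 1) ℕ.* k ℕ.+ m) * + M m k r      ≡⟨ cong (_* + M m k r) (ℤ.pos-+ ((m ℕ.+ 1) ℕ.* k) m) ⟩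
    (+ ((m ℕ.+ 1) ℕ.* k) + + m) * + M m k r    ≡⟨ cong (λ x → (x + + m) * + M m k r) (ℤ.pos-* (m ℕ.+ 1) k) ⟩
    (+ (m ℕ.+ 1) * + k + + m) * + M m k r      ≡⟨ cong (λ x → (x * + k + + m) * + M m k r) (ℤ.pos-+ m 1) ⟩
    ((+ m + 1ℤ) * + k + + m) * + M m k r       ∎
    where open ≡-Reasoning

S-telescopes : ∀ m r n c (T : ℕ → ℤ) → T 0 ≡ 0ℤ → (∀ k → c * summand m r k ≡ T (suc k) - T k) → c * S m r n ≡ T n
S-telescopes m r n c T T₀ differences = begin
  c * S m r n                  ≡⟨ cong (c *_) (S-as-∑ m r n) ⟩
  c * ∑ n (summand m r)        ≡⟨ sym (∑-*ˡ n c (summand m r)) ⟩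
  ∑ n (λ k → c * summand m r k) ≡⟨ ∑-cong n (λ {k} _ → differences k) ⟩
  ∑ n (λ k → T (suc k) - T k)  ≡⟨ ∑-telescope n T ⟩
  T n - T 0                    ≡⟨ cong (λ x → T n - x) T₀ ⟩
  T n - 0ℤ                     ≡⟨ ℤ.+-identityʳ (T n) ⟩
  T n                          ∎
  where open ≡-Reasoning

divide-out : ∀ c {d s X} → + suc c * s ≡ X → + suc c * d ∣ X → d ∣ s
divide-out c {d} {s} {X} cs≡X (divides q X≡q[cd]) = divides q (ℤ.*-cancelˡ-≡ (+ suc c) s (q * d) (begin
  + suc c * s       ≡⟨ cs≡X ⟩
  X                 ≡⟨ X≡q[cd] ⟩
  q * (+ suc c * d) ≡⟨ swap q (+ suc c) d ⟩
  + suc c * (q * d) ∎))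
  where
  open ≡-Reasoning
  swap : ∀ a b c → a * (b * c) ≡ b * (a * c)
  swap = solve-∀

-- r = 0: T(k) = (m+1)·k·C(k+m, m+1) telescopes S to (m+1)·n·C(n+m, m+1).
S-exponent-0 : ∀ m n → S (suc m) 0 n ≡ + suc m * + n * ((n ℕ.+ m) Cℤ suc m)
S-exponent-0 m n = trans (sym (ℤ.*-identityˡ (S (suc m) 0 n))) (S-telescopes (suc m) 0 n 1ℤ T T₀ difference)
  where
  open ≡-Reasoning
  M₁ : ℤ
  M₁ = + suc m
  T : ℕ → ℤ
  T k = M₁ * + k * ((k ℕ.+ m) Cℤ suc m)
  T₀ : T 0 ≡ 0ℤ
  T₀ = trans (cong (_* (m Cℤ suc m)) (ℤ.*-zeroʳ M₁)) (ℤ.*-zeroˡ (m Cℤ suc m))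
  difference : ∀ k → 1ℤ * summand (suc m) 0 k ≡ T (suc k) - T k
  difference k = begin
    1ℤ * (1ℤ * (((M₁ + 1ℤ) * + k + M₁) * + M (suc m) k 0))
      ≡⟨ cong (λ x → 1ℤ * (1ℤ * (((M₁ + 1ℤ) * + k + M₁) * x))) (M-exponent-0 m k) ⟩
    1ℤ * (1ℤ * (((M₁ + 1ℤ) * + k + M₁) * c₀))
      ≡⟨ collect (+ m) (+ k) c₀ ⟩
    M₁ * + suc k * c₀ + (+ k + + m - + m) * c₀
      ≡⟨ cong (λ x → M₁ * + suc k * c₀ + (x - + m) * c₀) (sym (ℤ.pos-+ k m)) ⟩
    M₁ * + suc k * c₀ + (+ (k ℕ.+ m) - + m) * c₀
      ≡⟨ cong (λ x → M₁ * + suc k * c₀ + x) (sym (row-ratio (k ℕ.+ m) m)) ⟩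
    M₁ * + suc k * c₀ + M₁ * c₁
      ≡⟨ expand (+ m) (+ k) c₀ c₁ ⟩
    M₁ * + suc k * (c₀ + c₁) - M₁ * + k * c₁
      ≡⟨ cong (λ x → M₁ * + suc k * x - M₁ * + k * c₁)
              (sym (trans (cong +_ (pascal (k ℕ.+ m) m)) (ℤ.pos-+ ((k ℕ.+ m) C m) _))) ⟩
    T (suc k) - T k ∎
    where
    c₀ c₁ : ℤ
    c₀ = (k ℕ.+ m) Cℤ m
    c₁ = (k ℕ.+ m) Cℤ suc m
    collect : ∀ m k c₀ → 1ℤ * (1ℤ * (((+ 1 + m + 1ℤ) * k + (+ 1 + m)) * c₀))
                       ≡ (+ 1 + m) * (+ 1 + k) * c₀ + (k + m - m) * c₀
    collect = solve-∀
    expand : ∀ m k c₀ c₁ → (+ 1 + m) * (+ 1 + k) * c₀ + (+ 1 + m) * c₁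
                         ≡ (+ 1 + m) * (+ 1 + k) * (c₀ + c₁) - (+ 1 + m) * k * c₁
    expand = solve-∀

-- Case (m, 0): mn ∣ m·n·C(n+m-1, m).
case-r0 : ∀ m n → + (suc m ℕ.* n) Unsigned.∣ S (suc m) 0 n
case-r0 m n = ∣⇒∣ᵤ (divides ((n ℕ.+ m) Cℤ suc m) (trans (S-exponent-0 m n)
  (trans (rearrange (+ suc m) (+ n) _) (cong (((n ℕ.+ m) Cℤ suc m) *_) (sym (ℤ.pos-* (suc m) n))))))
  where
  rearrange : ∀ a b c → a * b * c ≡ c * (a * b)
  rearrange = solve-∀

-- When (-1)^{rk} = (-1)^k and M_{m,k} = m^k, T(k) = -(-1)^k·k·m^k telescopes
-- S to -(-1)^n·n·m^n.  This covers r = 1, and m = 1 with r odd.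
S-alternating : ∀ m r n → (∀ k → signPow (r ℕ.* k) ≡ signPow k) → (∀ k → + M m k r ≡ (+ m) ^ k) →
  S m r n ≡ - signPow n * + n * (+ m) ^ n
S-alternating m r n sign power = trans (sym (ℤ.*-identityˡ (S m r n))) (S-telescopes m r n 1ℤ T refl difference)
  where
  T : ℕ → ℤ
  T k = - signPow k * + k * (+ m) ^ k
  difference : ∀ k → 1ℤ * summand m r k ≡ T (suc k) - T k
  difference k = trans (cong₂ (λ e x → 1ℤ * (e * (((+ m + 1ℤ) * + k + + m) * x))) (sign k) (power k))
                       (collect (signPow k) (+ k) (+ m) ((+ m) ^ k))
    where
    collect : ∀ e k m p → 1ℤ * (e * (((m + 1ℤ) * k + m) * p)) ≡ - - e * (+ 1 + k) * (m * p) - - e * k * p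
    collect = solve-∀

-- ... and then mn ∣ n·m^n.
case-alternating : ∀ m r n → 1 ≤ n → (∀ k → signPow (r ℕ.* k) ≡ signPow k) → (∀ k → + M (suc m) k r ≡ (+ suc m) ^ k) →
  + (suc m ℕ.* n) Unsigned.∣ S (suc m) r n
case-alternating m r (suc n) _ sign power = ∣⇒∣ᵤ (divides (- signPow (suc n) * (+ suc m) ^ n)
  (trans (S-alternating (suc m) r (suc n) sign power)
  (trans (rearrange (signPow (suc n)) (+ suc n) (+ suc m) ((+ suc m) ^ n))
         (cong (- signPow (suc n) * (+ suc m) ^ n *_) (sym (ℤ.pos-* (suc m) (suc n)))))))
  where
  rearrange : ∀ e n m p → - e * n * (m * p) ≡ - e * p * (m * n)
  rearrange = solve-∀

case-r1 : ∀ m n → 1 ≤ n → + (suc m ℕ.* n) Unsigned.∣ S (suc m) 1 n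
case-r1 m n 1≤n = case-alternating m 1 n 1≤n (λ k → cong signPow (ℕ.*-identityˡ k)) (M-exponent-1 (suc m))

-- Case (1, r): M_{1,k} = 1 for every r, so only the parity of r matters, and the
-- sum is the one for r = 0 or for r = 1.
case-m1 : ∀ r n → 1 ≤ n → + (1 ℕ.* n) Unsigned.∣ S 1 r n
case-m1 r n 1≤n with signPow-parity r
... | inj₁ even = subst (λ s → + (1 ℕ.* n) Unsigned.∣ s) (sym same-as-r0) (case-r0 0 n)
  where
  same-as-r0 : S 1 r n ≡ S 1 0 n
  same-as-r0 = trans (S-as-∑ 1 r n) (trans (∑-cong n (λ {k} _ →
    cong₂ (λ e x → e * (((+ 1 + 1ℤ) * + k + + 1) * x)) (even k) (trans (M[1,k]≡1 k r) (sym (M[1,k]≡1 k 0)))))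
    (sym (S-as-∑ 1 0 n)))
... | inj₂ odd = case-alternating 0 r n 1≤n odd (λ k → trans (M[1,k]≡1 k r) (sym (ℤ.^-zeroˡ k)))

-- (m,r) = (2,2): with s(k) = Σⱼ C(k,j)², T(k) = k·s(k) telescopes S to n·s(n).
S-22 : ∀ n → S 2 2 n ≡ + n * powerSum 2 n
S-22 n = trans (sym (ℤ.*-identityˡ (S 2 2 n))) (S-telescopes 2 2 n 1ℤ T refl difference)
  where
  T : ℕ → ℤ
  T k = + k * powerSum 2 k
  difference : ∀ k → 1ℤ * summand 2 2 k ≡ T (suc k) - T k
  difference k = begin
    1ℤ * (signPow (2 ℕ.* k) * (((+ 2 + 1ℤ) * + k + + 2) * + M 2 k 2))
      ≡⟨ cong₂ (λ e x → 1ℤ * (e * (((+ 2 + 1ℤ) * + k + + 2) * x))) (signPow-even k) (M[2,k]≡powerSum k 2) ⟩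
    1ℤ * (1ℤ * (((+ 2 + 1ℤ) * + k + + 2) * powerSum 2 k))
      ≡⟨ collect (+ k) (powerSum 2 k) ⟩
    + 2 * (+ 2 * + k + 1ℤ) * powerSum 2 k - + k * powerSum 2 k
      ≡⟨ cong (_- + k * powerSum 2 k) (sym (SquareSums.recurrence k)) ⟩
    T (suc k) - T k ∎
    where
    open ≡-Reasoning
    collect : ∀ k s → 1ℤ * (1ℤ * (((+ 2 + 1ℤ) * k + + 2) * s)) ≡ + 2 * (+ 2 * k + 1ℤ) * s - k * s
    collect = solve-∀

-- Case (2, 2): s(n) is even for n ≥ 1, so 2n ∣ n·s(n).
case-22 : ∀ n → 1 ≤ n → + (2 ℕ.* n) Unsigned.∣ S 2 2 n
case-22 (suc n) _ = ∣⇒∣ᵤ (even-part (squareSum-even n))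
  where
  open ≡-Reasoning
  rearrange : ∀ n q → n * (q * + 2) ≡ q * (+ 2 * n)
  rearrange = solve-∀
  even-part : + 2 ∣ powerSum 2 (suc n) → + (2 ℕ.* suc n) ∣ S 2 2 (suc n)
  even-part (divides q s≡2q) = divides q (begin
      S 2 2 (suc n)                    ≡⟨ S-22 (suc n) ⟩
      + suc n * powerSum 2 (suc n)     ≡⟨ cong (+ suc n *_) s≡2q ⟩
      + suc n * (q * + 2)              ≡⟨ rearrange (+ suc n) q ⟩
      q * (+ 2 * + suc n)              ≡⟨ cong (q *_) (sym (ℤ.pos-* 2 (suc n))) ⟩
      q * + (2 ℕ.* suc n)              ∎)

-- (m,r) = (2,3): with the Franel numbers f, T(k) = (-1)^k·k²·(f(k) - 8f(k-1))
-- telescopes 3S to (-1)^n·n²·(f(n) - 8f(n-1)).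
S-23 : ∀ n → + 3 * S 2 3 (suc n) ≡ signPow (suc n) * (+ suc n * + suc n) * (powerSum 3 (suc n) - + 8 * powerSum 3 n)
S-23 n = S-telescopes 2 3 (suc n) (+ 3) T refl difference
  where
  f : ℕ → ℤ
  f = powerSum 3
  T : ℕ → ℤ
  T zero    = 0ℤ
  T (suc k) = signPow (suc k) * (+ suc k * + suc k) * (f (suc k) - + 8 * f k)
  difference : ∀ k → + 3 * summand 2 3 k ≡ T (suc k) - T k
  difference zero    = refl
  difference (suc k) = begin
    + 3 * (signPow (3 ℕ.* suc k) * (((+ 2 + 1ℤ) * + suc k + + 2) * + M 2 (suc k) 3))
      ≡⟨ cong₂ (λ e x → + 3 * (e * (((+ 2 + 1ℤ) * + suc k + + 2) * x))) (signPow-odd (suc k)) (M[2,k]≡powerSum (suc k) 3) ⟩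
    + 3 * (e * (((+ 2 + 1ℤ) * + suc k + + 2) * f (suc k)))
      ≡⟨ collect e (+ k) (f (suc k)) (f k) ⟩
    - e * ((+ 7 * + k * + k + + 21 * + k + + 16) * f (suc k) + + 8 * + suc k * + suc k * f k)
      + e * (+ 8 * ((+ 2 + + k) * (+ 2 + + k)) * f (suc k) - + suc k * + suc k * f (suc k) + + 8 * (+ suc k * + suc k) * f k)
      ≡⟨ cong (λ x → - e * x + e * (+ 8 * ((+ 2 + + k) * (+ 2 + + k)) * f (suc k) - + suc k * + suc k * f (suc k) + + 8 * (+ suc k * + suc k) * f k))
              (sym (FranelNumbers.recurrence k)) ⟩
    - e * ((+ 2 + + k) * (+ 2 + + k) * f (suc (suc k)))
      + e * (+ 8 * ((+ 2 + + k) * (+ 2 + + k)) * f (suc k) - + suc k * + suc k * f (suc k) + + 8 * (+ suc k * + suc k) * f k)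
      ≡⟨ expand e (+ k) (f (suc (suc k))) (f (suc k)) (f k) ⟩
    T (suc (suc k)) - T (suc k) ∎
    where
    open ≡-Reasoning
    e : ℤ
    e = signPow (suc k)
    collect : ∀ e k f₁ f₀ →
      + 3 * (e * (((+ 2 + 1ℤ) * (+ 1 + k) + + 2) * f₁))
      ≡ - e * ((+ 7 * k * k + + 21 * k + + 16) * f₁ + + 8 * (+ 1 + k) * (+ 1 + k) * f₀)
        + e * (+ 8 * ((+ 2 + k) * (+ 2 + k)) * f₁ - (+ 1 + k) * (+ 1 + k) * f₁ + + 8 * ((+ 1 + k) * (+ 1 + k)) * f₀)
    collect = solve-∀
    expand : ∀ e k f₂ f₁ f₀ →
      - e * ((+ 2 + k) * (+ 2 + k) * f₂)
        + e * (+ 8 * ((+ 2 + k) * (+ 2 + k)) * f₁ - (+ 1 + k) * (+ 1 + k) * f₁ + + 8 * ((+ 1 + k) * (+ 1 + k)) * f₀)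
      ≡ - e * ((+ 2 + k) * (+ 2 + k)) * (f₂ - + 8 * f₁) - e * ((+ 1 + k) * (+ 1 + k)) * (f₁ - + 8 * f₀)
    expand = solve-∀

-- Case (2, 3): 6 ∣ f(n) - 8f(n-1), so 3·2n ∣ n²(f(n) - 8f(n-1)) = ±3S.
case-23 : ∀ n → 1 ≤ n → + (2 ℕ.* n) Unsigned.∣ S 2 3 n
case-23 (suc n) _ = ∣⇒∣ᵤ (divide-out 2 {+ (2 ℕ.* suc n)} (S-23 n) (scaled (franel-congruence n)))
  where
  open ≡-Reasoning
  rearrange : ∀ e n q → e * (n * n) * (q * + 6) ≡ e * n * q * (+ 3 * (+ 2 * n))
  rearrange = solve-∀
  scaled : + 6 ∣ powerSum 3 (suc n) - + 8 * powerSum 3 n →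
           + 3 * + (2 ℕ.* suc n) ∣ signPow (suc n) * (+ suc n * + suc n) * (powerSum 3 (suc n) - + 8 * powerSum 3 n)
  scaled (divides q f≡6q) = divides (signPow (suc n) * + suc n * q) (begin
      signPow (suc n) * (+ suc n * + suc n) * (powerSum 3 (suc n) - + 8 * powerSum 3 n)
        ≡⟨ cong (signPow (suc n) * (+ suc n * + suc n) *_) f≡6q ⟩
      signPow (suc n) * (+ suc n * + suc n) * (q * + 6)
        ≡⟨ rearrange (signPow (suc n)) (+ suc n) q ⟩
      signPow (suc n) * + suc n * q * (+ 3 * (+ 2 * + suc n))
        ≡⟨ cong (λ x → signPow (suc n) * + suc n * q * (+ 3 * x)) (sym (ℤ.pos-* 2 (suc n))) ⟩
      signPow (suc n) * + suc n * q * (+ 3 * + (2 ℕ.* suc n)) ∎)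

-- (m,r) = (3,2): with t(k) = M_{3,k}^{(2)}, T(k) = k²·(9t(k-1) - t(k)) telescopes
-- 2S to n²·(9t(n-1) - t(n)).
S-32 : ∀ n → + 2 * S 3 2 (suc n) ≡ + suc n * (+ suc n * (+ 9 * trinomialSquares n - trinomialSquares (suc n)))
S-32 n = S-telescopes 3 2 (suc n) (+ 2) T refl difference
  where
  t : ℕ → ℤ
  t = trinomialSquares
  T : ℕ → ℤ
  T zero    = 0ℤ
  T (suc k) = + suc k * (+ suc k * (+ 9 * t k - t (suc k)))
  difference : ∀ k → + 2 * summand 3 2 k ≡ T (suc k) - T k
  difference zero    = refl
  difference (suc k) = begin
    + 2 * (signPow (2 ℕ.* suc k) * (((+ 3 + 1ℤ) * + suc k + + 3) * + M 3 (suc k) 2))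
      ≡⟨ cong₂ (λ e x → + 2 * (e * (((+ 3 + 1ℤ) * + suc k + + 3) * x))) (signPow-even (suc k)) (M[3,k,2]≡trinomialSquares (suc k)) ⟩
    + 2 * (1ℤ * (((+ 3 + 1ℤ) * + suc k + + 3) * t (suc k)))
      ≡⟨ collect (+ k) (t (suc k)) ⟩
    + 9 * ((+ 2 + + k) * (+ 2 + + k)) * t (suc k) + + suc k * + suc k * t (suc k) - (+ 10 * + k * + k + + 30 * + k + + 23) * t (suc k)
      ≡⟨ cong (λ x → + 9 * ((+ 2 + + k) * (+ 2 + + k)) * t (suc k) + + suc k * + suc k * t (suc k) - x)
              (sym (TrinomialSquareSums.recurrence k)) ⟩
    + 9 * ((+ 2 + + k) * (+ 2 + + k)) * t (suc k) + + suc k * + suc k * t (suc k)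
      - ((+ 2 + + k) * (+ 2 + + k) * t (suc (suc k)) + + 9 * + suc k * + suc k * t k)
      ≡⟨ expand (+ k) (t (suc (suc k))) (t (suc k)) (t k) ⟩
    T (suc (suc k)) - T (suc k) ∎
    where
    open ≡-Reasoning
    collect : ∀ k t₁ → + 2 * (1ℤ * (((+ 3 + 1ℤ) * (+ 1 + k) + + 3) * t₁))
                     ≡ + 9 * ((+ 2 + k) * (+ 2 + k)) * t₁ + (+ 1 + k) * (+ 1 + k) * t₁ - (+ 10 * k * k + + 30 * k + + 23) * t₁
    collect = solve-∀
    expand : ∀ k t₂ t₁ t₀ →
      + 9 * ((+ 2 + k) * (+ 2 + k)) * t₁ + (+ 1 + k) * (+ 1 + k) * t₁
        - ((+ 2 + k) * (+ 2 + k) * t₂ + + 9 * (+ 1 + k) * (+ 1 + k) * t₀)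
      ≡ (+ 2 + k) * ((+ 2 + k) * (+ 9 * t₁ - t₂)) - (+ 1 + k) * ((+ 1 + k) * (+ 9 * t₀ - t₁))
    expand = solve-∀

two-and-three : ∀ {x} → + 2 ∣ x → + 3 ∣ x → + 6 ∣ x
two-and-three {x} (divides a x≡2a) (divides b x≡3b) = divides (a - b) (begin
  x                       ≡⟨ split x ⟩
  + 3 * x - + 2 * x       ≡⟨ cong₂ (λ u v → + 3 * u - + 2 * v) x≡2a x≡3b ⟩
  + 3 * (a * + 2) - + 2 * (b * + 3) ≡⟨ collect a b ⟩
  (a - b) * + 6           ∎)
  where
  open ≡-Reasoning
  split : ∀ x → x ≡ + 3 * x - + 2 * x
  split = solve-∀
  collect : ∀ a b → + 3 * (a * + 2) - + 2 * (b * + 3) ≡ (a - b) * + 6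
  collect = solve-∀

-- Case (3, 2): n(9t(n-1) - t(n)) is even (t is odd) and a multiple of 3
-- (as 3 ∣ n·t(n)), so 2·3n ∣ n²(9t(n-1) - t(n)) = 2S.
case-32 : ∀ n → 1 ≤ n → + (3 ℕ.* n) Unsigned.∣ S 3 2 n
case-32 (suc n) _ = ∣⇒∣ᵤ (divide-out 1 {+ (3 ℕ.* suc n)} (S-32 n)
  (subst (_∣ + suc n * y) (sym scale) (*-monoʳ-∣ (+ suc n) (two-and-three even multiple-of-3))))
  where
  t₀ t₁ y : ℤ
  t₀ = trinomialSquares n
  t₁ = trinomialSquares (suc n)
  y = + suc n * (+ 9 * t₀ - t₁)
  -- 9t₀ - t₁ = 9(t₀ - 1) - (t₁ - 1) + 8 is even, since t₀ and t₁ are odd.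
  even : + 2 ∣ y
  even = ∣n⇒∣m*n (+ suc n) (subst (+ 2 ∣_) (regroup t₀ t₁)
    (∣m∣n⇒∣m+n (∣m∣n⇒∣m-n (∣n⇒∣m*n (+ 9) (trinomialSquares-odd n)) (trinomialSquares-odd (suc n))) (divides (+ 4) refl)))
    where
    regroup : ∀ t₀ t₁ → + 9 * (t₀ - 1ℤ) - (t₁ - 1ℤ) + + 8 ≡ + 9 * t₀ - t₁
    regroup = solve-∀
  -- (n+1)(9t₀ - t₁) = 9(n+1)t₀ - (n+1)t₁, and 3 ∣ (n+1)t₁.
  multiple-of-3 : + 3 ∣ y
  multiple-of-3 = subst (+ 3 ∣_) (regroup (+ suc n) t₀ t₁)
    (∣m∣n⇒∣m-n (divides (+ 3 * + suc n * t₀) (triple (+ suc n) t₀)) (three-divides (suc n)))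
    where
    regroup : ∀ n t₀ t₁ → + 9 * n * t₀ - n * t₁ ≡ n * (+ 9 * t₀ - t₁)
    regroup = solve-∀
    triple : ∀ n t₀ → + 9 * n * t₀ ≡ + 3 * n * t₀ * + 3
    triple = solve-∀
  scale : + 2 * + (3 ℕ.* suc n) ≡ + suc n * + 6
  scale = trans (cong (+ 2 *_) (ℤ.pos-* 3 (suc n))) (commute (+ suc n))
    where
    commute : ∀ n → + 2 * (+ 3 * n) ≡ n * + 6
    commute = solve-∀

proposition4p1 : (m r : ℕ) → Admissible m r → (n : ℕ) → 1 ≤ n →
    (+ (m ℕ.* n)) Unsigned.∣ S m r n
proposition4p1 (suc m) .0 (r0 .(suc m) _) n 1≤n = case-r0 m n
proposition4p1 (suc m) .1 (r1 .(suc m) _) n 1≤n = case-r1 m n 1≤n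
proposition4p1 .1      r  (m1 .r _)       n 1≤n = case-m1 r n 1≤n
proposition4p1 .2      .2 p22             n 1≤n = case-22 n 1≤n
proposition4p1 .2      .3 p23             n 1≤n = case-23 n 1≤n
proposition4p1 .3      .2 p32             n 1≤n = case-32 n 1≤n
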